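{- Let $n\ge3$ be an integer and $P$ a convex integer polygon with $P\cap n\mathbb{Z}^2=\varnothing$ such that each of the segments $[(0,0),(n,0)]$, $[(n,0),(n,n)]$, $[(0,n),(n,n)]$, $[(0,0),(0,n)]$ splits $P$. Then: (i) the frame $((n,0);-\mathbf e_1,\mathbf e_2)$ splits $Q_1$; (ii) $((n,n);-\mathbf e_1,-\mathbf e_2)$ splits $Q_2$; (iii) $((0,n);\mathbf e_1,-\mathbf e_2)$ splits $Q_3$; (iv) $((0,0);\mathbf e_1,\mathbf e_2)$ splits $Q_4$; (v) if all vertices of $P$ belong to a $(1,n)$-lattice $\Gamma$, then the large $\mathbf e_1$-step and the large $\mathbf e_2$-step of $\Gamma$ are both $\ge2$.
   Context: $\mathbf e_1=(1,0)$, $\mathbf e_2=(0,1)$. A segment splits a polygon if it divides it into two parts with nonempty interior. For a convex integer polygon $P$ let $\mathcal S=\min\{x_2:(x_1,x_2)\in P\}$, $\mathcal S_\pm$ the min/max of $x_1$ over points $(x_1,\mathcal S)\in P$; $\mathcal E=\max\{x_1\}$, $\mathcal E_\pm$ the min/max of $x_2$ over $(\mathcal E,x_2)\in P$; $\mathcal N=\max\{x_2\}$, $\mathcal N_\pm$ the min/max of $x_1$ over $(x_1,\mathcal N)\in P$; $\mathcal W=\min\{x_1\}$, $\mathcal W_\pm$ the min/max of $x_2$ over $(\mathcal W,x_2)\in P$. The maximal slopes are the boundary arcs of $P$ traversed counterclockwise: $Q_1$ from $(\mathcal S_+,\mathcal S)$ to $(\mathcal E,\mathcal E_-)$, $Q_2$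 from $(\mathcal E,\mathcal E_+)$ to $(\mathcal N_+,\mathcal N)$, $Q_3$ from $(\mathcal N_-,\mathcal N)$ to $(\mathcal W,\mathcal W_+)$, $Q_4$ from $(\mathcal W,\mathcal W_-)$ to $(\mathcal S_-,\mathcal S)$ (possibly single points). Slope: for a basis $(\mathbf f_1,\mathbf f_2)$ and vertices $\mathbf v_0,\dots,\mathbf v_N$ with $\mathbf v_i-\mathbf v_{i-1}=a_{i1}\mathbf f_1+a_{i2}\mathbf f_2$, $a_{i1}>0,a_{i2}<0$, $a_{i1}a_{i+1,2}-a_{i+1,1}a_{i2}>0$, the broken line $\mathbf v_0\dots\mathbf v_N$ is a slope w.r.t. $(\mathbf f_1,\mathbf f_2)$; a slope w.r.t. $(\mathbf f_1,\mathbf f_2)$ is also one w.r.t. $(\mathbf f_2,\mathbf f_1)$. $Q_1,Q_2,Q_3,Q_4$ are slopes w.r.t. $(\mathbf e_2,-\mathbf e_1)$, $(-\mathbf e_1,-\mathbf e_2)$, $(-\mathbf e_2,\mathbf e_1)$, $(\mathbf e_1,\mathbf e_2)$ respectively. An integer frame $(\mathbf o;\mathbf f_1,\mathbf f_2)$ ($\mathbf o\in\mathbb{Z}^2$, basis of $\mathbb{Z}^2$) splits a slope $Q$ w.r.t. $(\mathbf f_1,\mathbf f_2)$ if, in coordinates $\mathbf o+\lambda_1\mathbf f_1+\lambda_2\mathbf f_2$, one endpoint has $\lambda_1<0,\lambda_2>0$, the other has $\lambda_1>0,\lambda_2<0$, and some point of $Q$ has $\lambda_1,\lambda_2>0$.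 A lattice $\Gamma=A\mathbb{Z}^2$ ($A$ integer, $\det A\neq0$) is a $(1,n)$-lattice if the gcd of entries of $A$ is $1$ and $|\det A|=n$. The large $\mathbf e_j$-step of $\Gamma$ is the positive generator of $\{u\in\mathbb{Z}:u\mathbf e_j\in\Gamma\}$.
   Formalization: Points of the plane are taken in ℚ², so the polygon P and the maximal slopes Q₁, Q₂, Q₃, Q₄ consist of their points with rational coordinates. -}

module Defs where

open import Data.Nat as ℕ using (ℕ; zero; suc)
open import Data.Integer as ℤ using (ℤ; +_)
open import Data.Integer.GCD using () renaming (gcd to gcdℤ)
open import Data.Integer.Divisibility using () renaming (_∣_ to _∣ℤ_)
open import Data.Rational using (ℚ; 0ℚ; 1ℚ; _+_; _*_; _-_; -_; _≤_; _<_; _/_)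
open import Data.Fin using (Fin; zero; suc)
open import Data.Product using (Σ; ∃; _×_; _,_; proj₁; proj₂)
open import Data.Sum using (_⊎_)
open import Relation.Binary.PropositionalEquality using (_≡_)

ℤ² : Set
ℤ² = ℤ × ℤ

Pt : Set
Pt = ℚ × ℚ

toℚ : ℤ → ℚ
toℚ a = a / 1

toPt : ℤ² → Pt
toPt (a , b) = toℚ a , toℚ b

_⊕_ : Pt → Pt → Pt
(a , b) ⊕ (c , d) = (a + c) , (b + d)

_⊖_ : Pt → Pt → Pt
(a , b) ⊖ (c , d) = (a - c) , (b - d)

_·_ : ℚ → Pt → Pt
t · (a , b) = (t * a) , (t * b)

dot : Pt → Pt → ℚ
dot (a , b) (c , d) = (a * c) + (b * d)

cross : Pt → Pt → ℚ
cross (a , b) (c , d) = (a * d) - (b * c)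

-- Convex integer polygons: convex hull of finitely many integer points

sumFin : ∀ {m} → (Fin m → ℚ) → ℚ
sumFin {zero}  f = 0ℚ
sumFin {suc m} f = f zero + sumFin (λ i → f (suc i))

record IntPolygon : Set where
  field
    m    : ℕ
    gens : Fin m → ℤ²

open IntPolygon public

_∈P_ : Pt → IntPolygon → Set
x ∈P P = Σ (Fin (m P) → ℚ) λ w →
    (∀ i → 0ℚ ≤ w i)
  × (sumFin w ≡ 1ℚ)
  × (sumFin (λ i → w i * proj₁ (toPt (gens P i))) ≡ proj₁ x)
  × (sumFin (λ i → w i * proj₂ (toPt (gens P i))) ≡ proj₂ x)

IsVertex : IntPolygon → Pt → Set
IsVertex P x = x ∈P P × (∀ y z t → y ∈P P → z ∈P P → 0ℚ < t → t < 1ℚ →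
                           x ≡ (t · y) ⊕ ((1ℚ - t) · z) → y ≡ z)

OnSegment : Pt → Pt → Pt → Set
OnSegment a b x = (cross (b ⊖ a) (x ⊖ a) ≡ 0ℚ)
                × (0ℚ ≤ dot (x ⊖ a) (b ⊖ a))
                × (dot (x ⊖ a) (b ⊖ a) ≤ dot (b ⊖ a) (b ⊖ a))

-- the segment [a,b] divides P into two parts with nonempty interior:
-- P meets the line ab only inside the segment, and P has points strictly
-- on both sides of the line ab.
SegmentSplits : Pt → Pt → IntPolygon → Set
SegmentSplits a b P =
    (∀ x → x ∈P P → cross (b ⊖ a) (x ⊖ a) ≡ 0ℚ → OnSegment a b x)
  × (∃ λ x → x ∈P P × (0ℚ < cross (b ⊖ a) (x ⊖ a)))
  × (∃ λ x → x ∈P P × (cross (b ⊖ a) (x ⊖ a) < 0ℚ))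

LexExtreme : IntPolygon → Pt → Pt → Pt → Set
LexExtreme P u v p = p ∈P P
  × (∀ x → x ∈P P → dot u x ≤ dot u p)
  × (∀ x → x ∈P P → dot u x ≡ dot u p → dot v x ≤ dot v p)

e₁ e₂ -e₁ -e₂ : Pt
e₁  = 1ℚ , 0ℚ
e₂  = 0ℚ , 1ℚ
-e₁ = - 1ℚ , 0ℚ
-e₂ = 0ℚ , - 1ℚ

IsSPlus  : IntPolygon → Pt → Set
IsSPlus P = LexExtreme P -e₂ e₁
IsSMinus : IntPolygon → Pt → Set
IsSMinus P = LexExtreme P -e₂ -e₁
IsEMinus : IntPolygon → Pt → Set
IsEMinus P = LexExtreme P e₁ -e₂
IsEPlus  : IntPolygon → Pt → Set
IsEPlus P = LexExtreme P e₁ e₂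
IsNPlus  : IntPolygon → Pt → Set
IsNPlus P = LexExtreme P e₂ e₁
IsNMinus : IntPolygon → Pt → Set
IsNMinus P = LexExtreme P e₂ -e₁
IsWPlus  : IntPolygon → Pt → Set
IsWPlus P = LexExtreme P -e₁ e₂
IsWMinus : IntPolygon → Pt → Set
IsWMinus P = LexExtreme P -e₁ -e₂

-- Each maximal slope Q_i (a counterclockwise boundary arc of the convex
-- polygon P between two of the extreme points above) is exactly the set of
-- points of P that are Pareto-maximal for a pair of coordinate functionals
-- (u , v): no other point y of P has u.y >= u.x and v.y >= v.x.
Pareto : IntPolygon → Pt → Pt → Pt → Set
Pareto P u v x = x ∈P P
  × (∀ y → y ∈P P → dot u x ≤ dot u y → dot v x ≤ dot v y → y ≡ x)

-- Q₁ : from (𝒮₊,𝒮) to (ℰ,ℰ₋)   (lower right arc)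
Q₁ Q₂ Q₃ Q₄ : IntPolygon → Pt → Set
Q₁ P = Pareto P e₁ -e₂
-- Q₂ : from (ℰ,ℰ₊) to (𝒩₊,𝒩)   (upper right arc)
Q₂ P = Pareto P e₁ e₂
-- Q₃ : from (𝒩₋,𝒩) to (𝒲,𝒲₊)   (upper left arc)
Q₃ P = Pareto P -e₁ e₂
-- Q₄ : from (𝒲,𝒲₋) to (𝒮₋,𝒮)   (lower left arc)
Q₄ P = Pareto P -e₁ -e₂

-- coordinates λ₁, λ₂ of x in the integer frame (o ; f₁ , f₂), i.e.
-- x = o + λ₁ f₁ + λ₂ f₂.  Since det(f₁,f₂) = ±1 for an integer frame,
-- 1 / det(f₁,f₂) = det(f₁,f₂), so Cramer's rule gives:
coord₁ : ℤ² → ℤ² → ℤ² → Pt → ℚ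
coord₁ o f₁ f₂ x = cross (x ⊖ toPt o) (toPt f₂) * cross (toPt f₁) (toPt f₂)

coord₂ : ℤ² → ℤ² → ℤ² → Pt → ℚ
coord₂ o f₁ f₂ x = cross (toPt f₁) (x ⊖ toPt o) * cross (toPt f₁) (toPt f₂)

FrameSplits : ℤ² → ℤ² → ℤ² → Pt → Pt → (Pt → Set) → Set
FrameSplits o f₁ f₂ a b Q =
  ( ((coord₁ o f₁ f₂ a < 0ℚ) × (0ℚ < coord₂ o f₁ f₂ a)
      × (0ℚ < coord₁ o f₁ f₂ b) × (coord₂ o f₁ f₂ b < 0ℚ))
  ⊎ ((coord₁ o f₁ f₂ b < 0ℚ) × (0ℚ < coord₂ o f₁ f₂ b)
      × (0ℚ < coord₁ o f₁ f₂ a) × (coord₂ o f₁ f₂ a < 0ℚ)) )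
  × (∃ λ x → Q x × (0ℚ < coord₁ o f₁ f₂ x) × (0ℚ < coord₂ o f₁ f₂ x))

record Mat : Set where
  constructor mat
  field
    a b c d : ℤ

matApply : Mat → ℤ² → ℤ²
matApply (mat a b c d) (k₁ , k₂) = (a ℤ.* k₁ ℤ.+ b ℤ.* k₂) , (c ℤ.* k₁ ℤ.+ d ℤ.* k₂)

detM : Mat → ℤ
detM (mat a b c d) = a ℤ.* d ℤ.- b ℤ.* c

_∈Γ_ : ℤ² → Mat → Set
x ∈Γ A = ∃ λ k → matApply A k ≡ x

_∈Γℚ_ : Pt → Mat → Set
x ∈Γℚ A = ∃ λ k → toPt (matApply A k) ≡ x

Is1nLattice : ℕ → Mat → Set
Is1nLattice n (mat a b c d) =
  (gcdℤ (gcdℤ a b) (gcdℤ c d) ≡ + 1) × (ℤ.∣ detM (mat a b c d) ∣ ≡ n)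

IsLargeStep₁ : Mat → ℕ → Set
IsLargeStep₁ A s = (0 ℕ.< s) × ((+ s , + 0) ∈Γ A)
                 × (∀ u → (u , + 0) ∈Γ A → (+ s) ∣ℤ u)

IsLargeStep₂ : Mat → ℕ → Set
IsLargeStep₂ A s = (0 ℕ.< s) × ((+ 0 , + s) ∈Γ A)
                 × (∀ u → (+ 0 , u) ∈Γ A → (+ s) ∣ℤ u)

-- Fix a corner of the square [0,n]² and the frame there pointing into the square, with coordinates
-- λ₁, λ₂.  The two sides of the square through the corner split P, so P crosses both frame axes,
-- meets them only on their positive halves and misses the corner; by convexity P then misses the
-- whole closed negative quadrant.  Hence the endpoint of the maximal slope that is extreme in the
-- direction of decreasing λ₁ has λ₁ < 0 < λ₂, and the other endpoint λ₂ < 0 < λ₁.  For the point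
-- inside the quadrant: of the edges between generators crossing a low level λ₂ = h > 0, the one
-- crossing lowest in λ₁ supports P, and its supporting functional a λ₁ + b λ₂ has a, b > 0.  Its
-- minimisers on P therefore lie on the maximal slope, and those just off the λ₁-axis lie in the
-- open positive quadrant.  For (v), the vertex (𝒲, 𝒲₋) has 0 < x₂ < n by the endpoint signs at the
-- corners (0,0) and (0,n), while e₁ ∈ Γ would make every x₂ on Γ a multiple of det Γ = ±n;
-- symmetrically for (𝒮₋, 𝒮) and e₂.

module Submission where

open import Defs
open import Data.Empty using (⊥; ⊥-elim)
open import Data.Fin using (Fin; zero; suc)
open import Data.Integer as ℤ using (ℤ; +_; -[1+_]) renaming (_*_ to _*ℤ_)
import Data.Integer.Properties as ℤ
open import Data.Integer.Divisibility.Signed using (_∣_; divides; ∣⇒∣ᵤ)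
open import Data.Integer.GCD using () renaming (gcd to gcdℤ)
import Data.Integer.Tactic.RingSolver as ℤ-Ring
open import Data.List using (List; allFin; cartesianProduct; filter)
open import Data.List.Membership.Propositional using (_∈_)
open import Data.List.Membership.Propositional.Properties using (∈-allFin; ∈-cartesianProduct⁺; ∈-filter⁺)
open import Data.List.Relation.Unary.All using (lookup)
open import Data.List.Relation.Unary.All.Properties using (all-filter)
open import Data.Nat as ℕ using (ℕ; zero; suc; s≤s; z≤n)
import Data.Nat.Divisibility as ℕ
import Data.Nat.GCD as ℕ
import Data.Nat.Properties as ℕ
open import Data.Product using (Σ; ∃; _×_; _,_; proj₁; proj₂; uncurry)
open import Data.Rational
  using (ℚ; 0ℚ; 1ℚ; _+_; _*_; _-_; -_; _≤_; _<_; 1/_; ↥_; ↧_; NonZero; positive; nonNegative; ≢-nonZero)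
open import Data.Rational.Properties
import Data.Sum as Sum
open import Data.Sum using (inj₁)
open import Data.Unit using (⊤; tt)
open import Function using (flip)
open import Level using (0ℓ)
open import Relation.Binary.Bundles using (DecTotalOrder)
open import Relation.Binary.Definitions using (tri<; tri≈; tri>)
open import Relation.Binary.PropositionalEquality
open import Relation.Nullary using (¬_; Dec; yes; no)
open import Relation.Nullary.Decidable using (dec⇒maybe; _×-dec_)
open import Relation.Unary using (Decidable)
open import Tactic.RingSolver using (solve-∀)
import Tactic.RingSolver.Core.AlmostCommutativeRing as ACR
open import Data.List.Extrema (DecTotalOrder.totalOrder ≤-decTotalOrder) using (argmin; argmin-all; f[argmin]≤f[xs])

ℚ-ring : ACR.AlmostCommutativeRing 0ℓ 0ℓ
ℚ-ring = ACR.fromCommutativeRing +-*-commutativeRing (λ q → dec⇒maybe (0ℚ ≟ q))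

q-p+p≡q : ∀ p q → q - p + p ≡ q
q-p+p≡q = solve-∀ ℚ-ring

≤-by-difference : ∀ {p q} e → q - p ≡ e → 0ℚ ≤ e → p ≤ q
≤-by-difference {p} {q} e q-p≡e 0≤e =
  subst₂ _≤_ (+-identityˡ p) (q-p+p≡q p q) (+-monoˡ-≤ p (subst (0ℚ ≤_) (sym q-p≡e) 0≤e))

<-by-difference : ∀ {p q} e → q - p ≡ e → 0ℚ < e → p < q
<-by-difference {p} {q} e q-p≡e 0<e =
  subst₂ _<_ (+-identityˡ p) (q-p+p≡q p q) (+-monoˡ-< p (subst (0ℚ <_) (sym q-p≡e) 0<e))

p≤q⇒0≤q-p : ∀ {p q} → p ≤ q → 0ℚ ≤ q - p
p≤q⇒0≤q-p {p} {q} p≤q = subst (_≤ q - p) (+-inverseʳ p) (+-monoˡ-≤ (- p) p≤q)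

p<q⇒0<q-p : ∀ {p q} → p < q → 0ℚ < q - p
p<q⇒0<q-p {p} {q} p<q = subst (_< q - p) (+-inverseʳ p) (+-monoˡ-< (- p) p<q)

p<q⇒p-q<0 : ∀ {p q} → p < q → p - q < 0ℚ
p<q⇒p-q<0 {p} {q} p<q = <-by-difference (q - p) (flip-sign p q) (p<q⇒0<q-p p<q)
  where
  flip-sign : ∀ p q → 0ℚ - (p - q) ≡ q - p
  flip-sign = solve-∀ ℚ-ring

p-q<0⇒p<q : ∀ {p q} → p - q < 0ℚ → p < q
p-q<0⇒p<q {p} {q} p-q<0 = <-by-difference (0ℚ - (p - q)) (flip-sign p q) (p<q⇒0<q-p p-q<0)
  where
  flip-sign : ∀ p q → q - p ≡ 0ℚ - (p - q)
  flip-sign = solve-∀ ℚ-ring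

p-q≡0⇒p≡q : ∀ {p q} → p - q ≡ 0ℚ → p ≡ q
p-q≡0⇒p≡q {p} {q} p-q≡0 = trans (sym (q-p+p≡q q p)) (trans (cong (_+ q) p-q≡0) (+-identityˡ q))

≤∧≢⇒< : ∀ {p q} → p ≤ q → p ≢ q → p < q
≤∧≢⇒< {p} {q} p≤q p≢q with <-cmp p q
... | tri< p<q _ _ = p<q
... | tri≈ _ p≡q _ = ⊥-elim (p≢q p≡q)
... | tri> _ _ q<p = ⊥-elim (<-irrefl refl (<-≤-trans q<p p≤q))

*-nonNeg : ∀ {p q} → 0ℚ ≤ p → 0ℚ ≤ q → 0ℚ ≤ p * q
*-nonNeg {p} {q} 0≤p 0≤q = nonNegative⁻¹ (p * q) {{nonNeg*nonNeg⇒nonNeg p {{nonNegative 0≤p}} q {{nonNegative 0≤q}}}}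

*-pos : ∀ {p q} → 0ℚ < p → 0ℚ < q → 0ℚ < p * q
*-pos {p} {q} 0<p 0<q = positive⁻¹ (p * q) {{pos*pos⇒pos p {{positive 0<p}} q {{positive 0<q}}}}

nonNeg-factor : ∀ {t d} → 0ℚ < t → 0ℚ ≤ t * d → 0ℚ ≤ d
nonNeg-factor {t} {d} 0<t 0≤td = *-cancelˡ-≤-pos t {{positive 0<t}} (subst (_≤ t * d) (sym (*-zeroʳ t)) 0≤td)

pos-factor : ∀ {t d} → 0ℚ < t → 0ℚ < t * d → 0ℚ < d
pos-factor {t} {d} 0<t 0<td = *-cancelˡ-<-nonNeg t {{nonNegative (<⇒≤ 0<t)}} (subst (_< t * d) (sym (*-zeroʳ t)) 0<td)

neg-factor : ∀ {t d} → 0ℚ < t → t * d < 0ℚ → d < 0ℚ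
neg-factor {t} {d} 0<t td<0 = *-cancelˡ-<-nonNeg t {{nonNegative (<⇒≤ 0<t)}} (subst (t * d <_) (sym (*-zeroʳ t)) td<0)

*-monoˡ-≤-on-support : ∀ {c a b} → 0ℚ ≤ c → (0ℚ < c → a ≤ b) → c * a ≤ c * b
*-monoˡ-≤-on-support {c} {a} {b} 0≤c a≤b with 0ℚ <? c
... | yes 0<c = *-monoˡ-≤-nonNeg c {{nonNegative 0≤c}} (a≤b 0<c)
... | no  0≮c = subst (λ c → c * a ≤ c * b) (≤-antisym 0≤c (≮⇒≥ 0≮c))
                  (≤-reflexive (trans (*-zeroˡ a) (sym (*-zeroˡ b))))

*-cancelˡ-≡0 : ∀ {c a} → 0ℚ < c → c * a ≡ 0ℚ → a ≡ 0ℚ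
*-cancelˡ-≡0 {c} {a} 0<c ca≡0 =
  ≤-antisym (*-cancelˡ-≤-pos c {{positive 0<c}} (≤-reflexive (trans ca≡0 (sym (*-zeroʳ c)))))
            (*-cancelˡ-≤-pos c {{positive 0<c}} (≤-reflexive (trans (*-zeroʳ c) (sym ca≡0))))

*-cancelˡ-≡ : ∀ c {a b} → c ≢ 0ℚ → c * a ≡ c * b → a ≡ b
*-cancelˡ-≡ c {a} {b} c≢0 ca≡cb = begin
  a               ≡⟨ sym (*-identityˡ a) ⟩
  1ℚ * a          ≡⟨ cong (_* a) (sym (*-inverseˡ c)) ⟩
  1/ c * c * a    ≡⟨ *-assoc (1/ c) c a ⟩
  1/ c * (c * a)  ≡⟨ cong (1/ c *_) ca≡cb ⟩
  1/ c * (c * b)  ≡⟨ sym (*-assoc (1/ c) c b) ⟩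
  1/ c * c * b    ≡⟨ cong (_* b) (*-inverseˡ c) ⟩
  1ℚ * b          ≡⟨ *-identityˡ b ⟩
  b               ∎
  where
  open ≡-Reasoning
  instance
    c-nonZero : NonZero c
    c-nonZero = ≢-nonZero c≢0

nonNeg+nonNeg≡0 : ∀ {p q} → 0ℚ ≤ p → 0ℚ ≤ q → p + q ≡ 0ℚ → p ≡ 0ℚ × q ≡ 0ℚ
nonNeg+nonNeg≡0 {p} {q} 0≤p 0≤q p+q≡0 =
  ≤-antisym (subst₂ _≤_ (+-identityʳ p) p+q≡0 (+-monoʳ-≤ p 0≤q)) 0≤p ,
  ≤-antisym (subst₂ _≤_ (+-identityˡ q) p+q≡0 (+-monoˡ-≤ q 0≤p)) 0≤q

positive-combination-≡ : ∀ {a b p p' q q'} → 0ℚ < a → 0ℚ < b → p' ≤ p → q' ≤ q →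
                         a * p + b * q ≤ a * p' + b * q' → p' ≡ p × q' ≡ q
positive-combination-≡ {a} {b} {p} {p'} {q} {q'} 0<a 0<b p'≤p q'≤q reversed =
  sym (p-q≡0⇒p≡q (*-cancelˡ-≡0 0<a (proj₁ both≡0))) , sym (p-q≡0⇒p≡q (*-cancelˡ-≡0 0<b (proj₂ both≡0)))
  where
  0≤a[p-p'] = *-nonNeg (<⇒≤ 0<a) (p≤q⇒0≤q-p p'≤p)
  0≤b[q-q'] = *-nonNeg (<⇒≤ 0<b) (p≤q⇒0≤q-p q'≤q)
  regroup : ∀ a b p p' q q' → 0ℚ - (a * (p - p') + b * (q - q')) ≡ (a * p' + b * q') - (a * p + b * q)
  regroup = solve-∀ ℚ-ring
  both≡0 = nonNeg+nonNeg≡0 0≤a[p-p'] 0≤b[q-q']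
    (≤-antisym (≤-by-difference _ (regroup a b p p' q q') (p≤q⇒0≤q-p reversed)) (+-mono-≤ 0≤a[p-p'] 0≤b[q-q']))

mix-of-equal : ∀ t a → t * a + (1ℚ - t) * a ≡ a
mix-of-equal = solve-∀ ℚ-ring

below-left-mix : ∀ {t a c} → 0ℚ < t → c ≤ t * a + (1ℚ - t) * c → c ≤ a
below-left-mix {t} {a} {c} 0<t c≤mix =
  ≤-by-difference (a - c) refl (nonNeg-factor 0<t (subst (0ℚ ≤_) (excess t a c) (p≤q⇒0≤q-p c≤mix)))
  where
  excess : ∀ t a c → (t * a + (1ℚ - t) * c) - c ≡ t * (a - c)
  excess = solve-∀ ℚ-ring

below-right-mix : ∀ {t a c} → t < 1ℚ → c ≤ t * c + (1ℚ - t) * a → c ≤ a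
below-right-mix {t} {a} {c} t<1 c≤mix =
  ≤-by-difference (a - c) refl (nonNeg-factor (p<q⇒0<q-p t<1) (subst (0ℚ ≤_) (excess t a c) (p≤q⇒0≤q-p c≤mix)))
  where
  excess : ∀ t a c → (t * c + (1ℚ - t) * a) - c ≡ (1ℚ - t) * (a - c)
  excess = solve-∀ ℚ-ring

minimiser : ∀ {A : Set} {Pr : A → Set} (xs : List A) → (∀ a → a ∈ xs) → Decidable Pr →
            (f : A → ℚ) → Σ A Pr → Σ A λ a → Pr a × (∀ b → Pr b → f a ≤ f b)
minimiser xs complete Pr? f (a₀ , Pr-a₀) =
  best , argmin-all f Pr-a₀ (all-filter Pr? xs) ,
  λ b Pr-b → lookup (f[argmin]≤f[xs] a₀ candidates) (∈-filter⁺ Pr? (complete b) Pr-b)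
  where
  candidates = filter Pr? xs
  best = argmin f a₀ candidates

index-minimiser : ∀ {k} {Pr : Fin k → Set} → Decidable Pr → (f : Fin k → ℚ) → Σ (Fin k) Pr →
                  Σ (Fin k) λ i → Pr i × (∀ j → Pr j → f i ≤ f j)
index-minimiser = minimiser (allFin _) ∈-allFin

index-pair-minimiser : ∀ {k} {Pr : Fin k × Fin k → Set} → Decidable Pr → (f : Fin k × Fin k → ℚ) →
                       Σ (Fin k × Fin k) Pr → Σ (Fin k × Fin k) λ p → Pr p × (∀ q → Pr q → f p ≤ f q)
index-pair-minimiser = minimiser (cartesianProduct (allFin _) (allFin _))
  (λ (i , j) → ∈-cartesianProduct⁺ (∈-allFin i) (∈-allFin j))

sumFin-cong : ∀ {k} {f g : Fin k → ℚ} → (∀ i → f i ≡ g i) → sumFin f ≡ sumFin g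
sumFin-cong {zero}  f≡g = refl
sumFin-cong {suc k} f≡g = cong₂ _+_ (f≡g zero) (sumFin-cong (λ i → f≡g (suc i)))

sumFin-linear : ∀ {k} a b (f g : Fin k → ℚ) →
                sumFin (λ i → a * f i + b * g i) ≡ a * sumFin f + b * sumFin g
sumFin-linear {zero}  a b f g = sym (zeros a b)
  where
  zeros : ∀ a b → a * 0ℚ + b * 0ℚ ≡ 0ℚ
  zeros = solve-∀ ℚ-ring
sumFin-linear {suc k} a b f g = begin
  (a * f zero + b * g zero) + sumFin (λ i → a * f (suc i) + b * g (suc i))
    ≡⟨ cong (λ r → a * f zero + b * g zero + r) (sumFin-linear a b (λ i → f (suc i)) (λ i → g (suc i))) ⟩
  (a * f zero + b * g zero) + (a * sumFin (λ i → f (suc i)) + b * sumFin (λ i → g (suc i)))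
    ≡⟨ regroup a b (f zero) (g zero) _ _ ⟩
  a * sumFin f + b * sumFin g ∎
  where
  open ≡-Reasoning
  regroup : ∀ a b x y X Y → (a * x + b * y) + (a * X + b * Y) ≡ a * (x + X) + b * (y + Y)
  regroup = solve-∀ ℚ-ring

sumFin-mix : ∀ {k} a b (w w' c : Fin k → ℚ) →
             sumFin (λ i → (a * w i + b * w' i) * c i) ≡ a * sumFin (λ i → w i * c i) + b * sumFin (λ i → w' i * c i)
sumFin-mix a b w w' c =
  trans (sumFin-cong (λ i → distrib a b (w i) (w' i) (c i))) (sumFin-linear a b (λ i → w i * c i) (λ i → w' i * c i))
  where
  distrib : ∀ a b w w' c → (a * w + b * w') * c ≡ a * (w * c) + b * (w' * c)
  distrib = solve-∀ ℚ-ring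

sumFin-*ʳ : ∀ {k} (f : Fin k → ℚ) c → sumFin (λ i → f i * c) ≡ sumFin f * c
sumFin-*ʳ {zero}  f c = sym (*-zeroˡ c)
sumFin-*ʳ {suc k} f c =
  trans (cong (λ r → f zero * c + r) (sumFin-*ʳ (λ i → f (suc i)) c)) (sym (*-distribʳ-+ c (f zero) _))

sumFin-mono : ∀ {k} {f g : Fin k → ℚ} → (∀ i → f i ≤ g i) → sumFin f ≤ sumFin g
sumFin-mono {zero}  f≤g = ≤-refl
sumFin-mono {suc k} f≤g = +-mono-≤ (f≤g zero) (sumFin-mono (λ i → f≤g (suc i)))

sumFin-nonNeg : ∀ {k} {f : Fin k → ℚ} → (∀ i → 0ℚ ≤ f i) → 0ℚ ≤ sumFin f
sumFin-nonNeg {zero}  0≤f = ≤-refl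
sumFin-nonNeg {suc k} 0≤f = +-mono-≤ (0≤f zero) (sumFin-nonNeg (λ i → 0≤f (suc i)))

sumFin-nonNeg-≡0 : ∀ {k} {f : Fin k → ℚ} → (∀ i → 0ℚ ≤ f i) → sumFin f ≡ 0ℚ → ∀ i → f i ≡ 0ℚ
sumFin-nonNeg-≡0 {suc k} {f} 0≤f Σf≡0 = terms
  where
  split = nonNeg+nonNeg≡0 (0≤f zero) (sumFin-nonNeg (λ j → 0≤f (suc j))) Σf≡0
  terms : ∀ i → f i ≡ 0ℚ
  terms zero    = proj₁ split
  terms (suc i) = sumFin-nonNeg-≡0 (λ j → 0≤f (suc j)) (proj₂ split) i

indicator : ∀ {k} → Fin k → Fin k → ℚ
indicator zero    zero    = 1ℚ
indicator zero    (suc j) = 0ℚ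
indicator (suc i) zero    = 0ℚ
indicator (suc i) (suc j) = indicator i j

indicator-nonNeg : ∀ {k} (i j : Fin k) → 0ℚ ≤ indicator i j
indicator-nonNeg zero    zero    = nonNegative⁻¹ 1ℚ
indicator-nonNeg zero    (suc j) = ≤-refl
indicator-nonNeg (suc i) zero    = ≤-refl
indicator-nonNeg (suc i) (suc j) = indicator-nonNeg i j

sumFin-indicator : ∀ {k} (i : Fin k) (f : Fin k → ℚ) → sumFin (λ j → indicator i j * f j) ≡ f i
sumFin-indicator zero    f = begin
  1ℚ * f zero + sumFin (λ j → 0ℚ * tail j)    ≡⟨ cong₂ _+_ (*-identityˡ (f zero)) (sumFin-cong (λ j → *-comm 0ℚ (tail j))) ⟩
  f zero + sumFin (λ j → tail j * 0ℚ)          ≡⟨ cong (λ r → f zero + r) (sumFin-*ʳ tail 0ℚ) ⟩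
  f zero + sumFin tail * 0ℚ                    ≡⟨ cong (λ r → f zero + r) (*-zeroʳ (sumFin tail)) ⟩
  f zero + 0ℚ                                  ≡⟨ +-identityʳ (f zero) ⟩
  f zero                                       ∎
  where
  open ≡-Reasoning
  tail = λ j → f (suc j)
sumFin-indicator (suc i) f =
  trans (cong₂ _+_ (*-zeroˡ (f zero)) (sumFin-indicator i (λ j → f (suc j)))) (+-identityˡ (f (suc i)))

gen : (P : IntPolygon) → Fin (m P) → Pt
gen P i = toPt (gens P i)

gen∈P : ∀ P i → gen P i ∈P P
gen∈P P i = indicator i , indicator-nonNeg i ,
  trans (sumFin-cong (λ j → sym (*-identityʳ (indicator i j)))) (sumFin-indicator i (λ _ → 1ℚ)) ,
  sumFin-indicator i (λ j → proj₁ (gen P j)) , sumFin-indicator i (λ j → proj₂ (gen P j))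

-- the same parametrisation as in IsVertex
comb : ℚ → Pt → Pt → Pt
comb t y z = (t · y) ⊕ ((1ℚ - t) · z)

comb∈P : ∀ {P t y z} → 0ℚ ≤ t → t ≤ 1ℚ → y ∈P P → z ∈P P → comb t y z ∈P P
comb∈P {P} {t} 0≤t t≤1 (w , 0≤w , Σw , Σw₁ , Σw₂) (w' , 0≤w' , Σw' , Σw'₁ , Σw'₂) =
  (λ i → t * w i + (1ℚ - t) * w' i) ,
  (λ i → +-mono-≤ (*-nonNeg 0≤t (0≤w i)) (*-nonNeg (p≤q⇒0≤q-p t≤1) (0≤w' i))) ,
  trans (sumFin-linear t (1ℚ - t) w w') (trans (cong₂ mix Σw Σw') (mix-of-equal t 1ℚ)) ,
  trans (sumFin-mix t (1ℚ - t) w w' (λ i → proj₁ (gen P i))) (cong₂ mix Σw₁ Σw'₁) ,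
  trans (sumFin-mix t (1ℚ - t) w w' (λ i → proj₂ (gen P i))) (cong₂ mix Σw₂ Σw'₂)
  where
  mix : ℚ → ℚ → ℚ
  mix a b = t * a + (1ℚ - t) * b

index-of-unit-sum : ∀ {k} {w : Fin k → ℚ} → sumFin w ≡ 1ℚ → Fin k
index-of-unit-sum {zero}  ()
index-of-unit-sum {suc k} _ = zero

some-generator : ∀ {P x} → x ∈P P → Fin (m P)
some-generator (_ , _ , Σw≡1 , _) = index-of-unit-sum Σw≡1

Maximiser : IntPolygon → Pt → Pt → Set
Maximiser P u A = A ∈P P × (∀ x → x ∈P P → dot u x ≤ dot u A)

dot-comb : ∀ u t y z → dot u (comb t y z) ≡ t * dot u y + (1ℚ - t) * dot u z
dot-comb (u₁ , u₂) t (y₁ , y₂) (z₁ , z₂) = identity u₁ u₂ t y₁ y₂ z₁ z₂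
  where
  identity : ∀ u₁ u₂ t y₁ y₂ z₁ z₂ →
    u₁ * (t * y₁ + (1ℚ - t) * z₁) + u₂ * (t * y₂ + (1ℚ - t) * z₂)
      ≡ t * (u₁ * y₁ + u₂ * y₂) + (1ℚ - t) * (u₁ * z₁ + u₂ * z₂)
  identity = solve-∀ ℚ-ring

dot-injective : ∀ u v → cross u v ≢ 0ℚ → ∀ {x y} → dot u x ≡ dot u y → dot v x ≡ dot v y → x ≡ y
dot-injective (u₁ , u₂) (v₁ , v₂) D≢0 {x₁ , x₂} {y₁ , y₂} ux≡uy vx≡vy = cong₂ _,_
  (*-cancelˡ-≡ D D≢0 (begin
    D * x₁                                              ≡⟨ cramer₁ u₁ u₂ v₁ v₂ x₁ x₂ ⟩
    v₂ * (u₁ * x₁ + u₂ * x₂) - u₂ * (v₁ * x₁ + v₂ * x₂) ≡⟨ cong₂ (λ a b → v₂ * a - u₂ * b) ux≡uy vx≡vy ⟩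
    v₂ * (u₁ * y₁ + u₂ * y₂) - u₂ * (v₁ * y₁ + v₂ * y₂) ≡⟨ sym (cramer₁ u₁ u₂ v₁ v₂ y₁ y₂) ⟩
    D * y₁                                              ∎))
  (*-cancelˡ-≡ D D≢0 (begin
    D * x₂                                              ≡⟨ cramer₂ u₁ u₂ v₁ v₂ x₁ x₂ ⟩
    u₁ * (v₁ * x₁ + v₂ * x₂) - v₁ * (u₁ * x₁ + u₂ * x₂) ≡⟨ cong₂ (λ a b → u₁ * a - v₁ * b) vx≡vy ux≡uy ⟩
    u₁ * (v₁ * y₁ + v₂ * y₂) - v₁ * (u₁ * y₁ + u₂ * y₂) ≡⟨ sym (cramer₂ u₁ u₂ v₁ v₂ y₁ y₂) ⟩
    D * y₂                                              ∎))
  where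
  open ≡-Reasoning
  D = u₁ * v₂ - u₂ * v₁
  cramer₁ : ∀ u₁ u₂ v₁ v₂ x₁ x₂ →
            (u₁ * v₂ - u₂ * v₁) * x₁ ≡ v₂ * (u₁ * x₁ + u₂ * x₂) - u₂ * (v₁ * x₁ + v₂ * x₂)
  cramer₁ = solve-∀ ℚ-ring
  cramer₂ : ∀ u₁ u₂ v₁ v₂ x₁ x₂ →
            (u₁ * v₂ - u₂ * v₁) * x₂ ≡ u₁ * (v₁ * x₁ + v₂ * x₂) - v₁ * (u₁ * x₁ + u₂ * x₂)
  cramer₂ = solve-∀ ℚ-ring

-- Written with a minus sign so that it decreases along its gradient: the frame coordinates are of
-- this form with gradient the outward direction that the maximal slope maximises.
record Affine : Set where
  constructor affine
  field
    offset   : ℚ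
    gradient : Pt

open Affine public

⟦_⟧ : Affine → Pt → ℚ
⟦ φ ⟧ x = offset φ - dot (gradient φ) x

⟦⟧-comb : ∀ φ t y z → ⟦ φ ⟧ (comb t y z) ≡ t * ⟦ φ ⟧ y + (1ℚ - t) * ⟦ φ ⟧ z
⟦⟧-comb φ t y z = begin
  offset φ - dot (gradient φ) (comb t y z)
    ≡⟨ cong (λ d → offset φ - d) (dot-comb (gradient φ) t y z) ⟩
  offset φ - (t * dot (gradient φ) y + (1ℚ - t) * dot (gradient φ) z)
    ≡⟨ identity (offset φ) t _ _ ⟩
  t * ⟦ φ ⟧ y + (1ℚ - t) * ⟦ φ ⟧ z ∎
  where
  open ≡-Reasoning
  identity : ∀ K t a b → K - (t * a + (1ℚ - t) * b) ≡ t * (K - a) + (1ℚ - t) * (K - b)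
  identity = solve-∀ ℚ-ring

lincomb : ℚ → Affine → ℚ → Affine → Affine
lincomb a φ b ψ = affine (a * offset φ + b * offset ψ) ((a · gradient φ) ⊕ (b · gradient ψ))

⟦lincomb⟧ : ∀ a φ b ψ x → ⟦ lincomb a φ b ψ ⟧ x ≡ a * ⟦ φ ⟧ x + b * ⟦ ψ ⟧ x
⟦lincomb⟧ a (affine K (u₁ , u₂)) b (affine L (v₁ , v₂)) (x₁ , x₂) = identity a b K L u₁ u₂ v₁ v₂ x₁ x₂
  where
  identity : ∀ a b K L u₁ u₂ v₁ v₂ x₁ x₂ →
    (a * K + b * L) - ((a * u₁ + b * v₁) * x₁ + (a * u₂ + b * v₂) * x₂)
      ≡ a * (K - (u₁ * x₁ + u₂ * x₂)) + b * (L - (v₁ * x₁ + v₂ * x₂))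
  identity = solve-∀ ℚ-ring

lincomb-comb : ∀ a φ b ψ t y z → a * ⟦ φ ⟧ (comb t y z) + b * ⟦ ψ ⟧ (comb t y z)
                                 ≡ t * (a * ⟦ φ ⟧ y + b * ⟦ ψ ⟧ y) + (1ℚ - t) * (a * ⟦ φ ⟧ z + b * ⟦ ψ ⟧ z)
lincomb-comb a φ b ψ t y z = begin
  a * ⟦ φ ⟧ (comb t y z) + b * ⟦ ψ ⟧ (comb t y z)    ≡⟨ sym (⟦lincomb⟧ a φ b ψ (comb t y z)) ⟩
  ⟦ χ ⟧ (comb t y z)                                 ≡⟨ ⟦⟧-comb χ t y z ⟩
  t * ⟦ χ ⟧ y + (1ℚ - t) * ⟦ χ ⟧ z
    ≡⟨ cong₂ (λ p q → t * p + (1ℚ - t) * q) (⟦lincomb⟧ a φ b ψ y) (⟦lincomb⟧ a φ b ψ z) ⟩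
  t * (a * ⟦ φ ⟧ y + b * ⟦ ψ ⟧ y) + (1ℚ - t) * (a * ⟦ φ ⟧ z + b * ⟦ ψ ⟧ z) ∎
  where
  open ≡-Reasoning
  χ = lincomb a φ b ψ

⟦⟧-antitone : ∀ φ {x y} → dot (gradient φ) x ≤ dot (gradient φ) y → ⟦ φ ⟧ y ≤ ⟦ φ ⟧ x
⟦⟧-antitone φ {x} {y} ux≤uy = ≤-by-difference _ (shift (offset φ) _ _) (p≤q⇒0≤q-p ux≤uy)
  where
  shift : ∀ K a b → (K - a) - (K - b) ≡ b - a
  shift = solve-∀ ℚ-ring

⟦⟧-antitone⁻¹ : ∀ φ {x y} → ⟦ φ ⟧ y ≤ ⟦ φ ⟧ x → dot (gradient φ) x ≤ dot (gradient φ) y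
⟦⟧-antitone⁻¹ φ {x} {y} φy≤φx = ≤-by-difference _ (shift (offset φ) _ _) (p≤q⇒0≤q-p φy≤φx)
  where
  shift : ∀ K a b → b - a ≡ (K - a) - (K - b)
  shift = solve-∀ ℚ-ring

⟦⟧-injective : ∀ φ {x y} → ⟦ φ ⟧ x ≡ ⟦ φ ⟧ y → dot (gradient φ) x ≡ dot (gradient φ) y
⟦⟧-injective φ φx≡φy =
  ≤-antisym (⟦⟧-antitone⁻¹ φ (≤-reflexive (sym φx≡φy))) (⟦⟧-antitone⁻¹ φ (≤-reflexive φx≡φy))

module _ {P : IntPolygon} {x : Pt} (x∈P : x ∈P P) where

  private
    w = proj₁ x∈P
    0≤w = proj₁ (proj₂ x∈P)
    Σw  = proj₁ (proj₂ (proj₂ x∈P))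
    Σw₁ = proj₁ (proj₂ (proj₂ (proj₂ x∈P)))
    Σw₂ = proj₂ (proj₂ (proj₂ (proj₂ x∈P)))

  ⟦⟧-on-hull : ∀ φ → ⟦ φ ⟧ x ≡ sumFin (λ i → w i * ⟦ φ ⟧ (gen P i))
  ⟦⟧-on-hull (affine K (u₁ , u₂)) = sym (begin
    sumFin (λ i → w i * (K - dot (u₁ , u₂) (g i)))
      ≡⟨ sumFin-cong (λ i → expand (w i) K u₁ u₂ (proj₁ (g i)) (proj₂ (g i))) ⟩
    sumFin (λ i → K * w i + (- 1ℚ) * (u₁ * (w i * proj₁ (g i)) + u₂ * (w i * proj₂ (g i))))
      ≡⟨ sumFin-linear K (- 1ℚ) w _ ⟩
    K * sumFin w + (- 1ℚ) * sumFin (λ i → u₁ * (w i * proj₁ (g i)) + u₂ * (w i * proj₂ (g i)))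
      ≡⟨ cong₂ (λ a b → K * a + (- 1ℚ) * b) Σw (sumFin-linear u₁ u₂ (λ i → w i * proj₁ (g i)) _) ⟩
    K * 1ℚ + (- 1ℚ) * (u₁ * sumFin (λ i → w i * proj₁ (g i)) + u₂ * sumFin (λ i → w i * proj₂ (g i)))
      ≡⟨ cong₂ (λ a b → K * 1ℚ + (- 1ℚ) * (u₁ * a + u₂ * b)) Σw₁ Σw₂ ⟩
    K * 1ℚ + (- 1ℚ) * dot (u₁ , u₂) x
      ≡⟨ collapse K (dot (u₁ , u₂) x) ⟩
    K - dot (u₁ , u₂) x ∎)
    where
    open ≡-Reasoning
    g = gen P
    expand : ∀ w K u₁ u₂ g₁ g₂ →
             w * (K - (u₁ * g₁ + u₂ * g₂)) ≡ K * w + (- 1ℚ) * (u₁ * (w * g₁) + u₂ * (w * g₂))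
    expand = solve-∀ ℚ-ring
    collapse : ∀ K d → K * 1ℚ + (- 1ℚ) * d ≡ K - d
    collapse = solve-∀ ℚ-ring

  ⟦⟧-lower-bound-on-hull : ∀ φ {M} → (∀ i → 0ℚ < w i → M ≤ ⟦ φ ⟧ (gen P i)) → M ≤ ⟦ φ ⟧ x
  ⟦⟧-lower-bound-on-hull φ {M} M≤φ = begin
    M                                        ≡⟨ sym (*-identityˡ M) ⟩
    1ℚ * M                                   ≡⟨ cong (_* M) (sym Σw) ⟩
    sumFin w * M                             ≡⟨ sym (sumFin-*ʳ w M) ⟩
    sumFin (λ i → w i * M)                   ≤⟨ sumFin-mono (λ i → *-monoˡ-≤-on-support (0≤w i) (M≤φ i)) ⟩
    sumFin (λ i → w i * ⟦ φ ⟧ (gen P i))     ≡⟨ sym (⟦⟧-on-hull φ) ⟩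
    ⟦ φ ⟧ x                                  ∎
    where open ≤-Reasoning

  ⟦⟧-face : ∀ φ {M} → (∀ i → M ≤ ⟦ φ ⟧ (gen P i)) → ⟦ φ ⟧ x ≡ M →
            ∀ i → 0ℚ < w i → ⟦ φ ⟧ (gen P i) ≡ M
  ⟦⟧-face φ {M} M≤φ φx≡M i 0<wᵢ =
    p-q≡0⇒p≡q (*-cancelˡ-≡0 0<wᵢ (sumFin-nonNeg-≡0 0≤excess excess≡0 i))
    where
    open ≡-Reasoning
    f = λ j → ⟦ φ ⟧ (gen P j)
    0≤excess = λ j → *-nonNeg (0≤w j) (p≤q⇒0≤q-p (M≤φ j))
    expand : ∀ w f M → w * (f - M) ≡ 1ℚ * (w * f) + (- M) * w
    expand = solve-∀ ℚ-ring
    cancel : ∀ M → 1ℚ * M + (- M) * 1ℚ ≡ 0ℚ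
    cancel = solve-∀ ℚ-ring
    excess≡0 : sumFin (λ j → w j * (f j - M)) ≡ 0ℚ
    excess≡0 = begin
      sumFin (λ j → w j * (f j - M))                   ≡⟨ sumFin-cong (λ j → expand (w j) (f j) M) ⟩
      sumFin (λ j → 1ℚ * (w j * f j) + (- M) * w j)    ≡⟨ sumFin-linear 1ℚ (- M) (λ j → w j * f j) w ⟩
      1ℚ * sumFin (λ j → w j * f j) + (- M) * sumFin w
        ≡⟨ cong₂ (λ a b → 1ℚ * a + (- M) * b) (sym (⟦⟧-on-hull φ)) Σw ⟩
      1ℚ * ⟦ φ ⟧ x + (- M) * 1ℚ                        ≡⟨ cong (λ a → 1ℚ * a + (- M) * 1ℚ) φx≡M ⟩
      1ℚ * M + (- M) * 1ℚ                              ≡⟨ cancel M ⟩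
      0ℚ                                               ∎

minimising-generator : ∀ P {x} → x ∈P P → ∀ φ →
                       Σ (Fin (m P)) λ i → ∀ y → y ∈P P → ⟦ φ ⟧ (gen P i) ≤ ⟦ φ ⟧ y
minimising-generator P x∈P φ = i , λ y y∈P → ⟦⟧-lower-bound-on-hull {P} y∈P φ (λ j _ → minimal j tt)
  where
  least = index-minimiser {Pr = λ _ → ⊤} (λ _ → yes tt) (λ j → ⟦ φ ⟧ (gen P j)) (some-generator {P} x∈P , tt)
  i = proj₁ least
  minimal = proj₂ (proj₂ least)

-- The reciprocal of a positive rational, with junk value 0 elsewhere.
recip⁺ : ℚ → ℚ
recip⁺ q with 0ℚ <? q
... | yes 0<q = (1/ q) {{pos⇒nonZero q {{positive 0<q}}}}
... | no  _   = 0ℚ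

recip⁺-spec : ∀ {q} → 0ℚ < q → 0ℚ < recip⁺ q × q * recip⁺ q ≡ 1ℚ
recip⁺-spec {q} 0<q with 0ℚ <? q
... | yes 0<q' = positive⁻¹ _ {{1/pos⇒pos q {{positive 0<q'}}}} , *-inverseʳ q {{pos⇒nonZero q {{positive 0<q'}}}}
... | no  0≮q  = ⊥-elim (0≮q 0<q)

-- the weight t with t * a + (1 - t) * b ≡ h
crossing : ℚ → ℚ → ℚ → ℚ
crossing a b h = (b - h) * recip⁺ (b - a)

module _ {a b h : ℚ} (a≤h : a ≤ h) (h<b : h < b) where

  private
    r = recip⁺ (b - a)
    r-spec = recip⁺-spec (p<q⇒0<q-p (≤-<-trans a≤h h<b))
    t = crossing a b h

    1-t≡ : 1ℚ - t ≡ (h - a) * r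
    1-t≡ = begin
      1ℚ - (b - h) * r           ≡⟨ cong (_- (b - h) * r) (sym (proj₂ r-spec)) ⟩
      (b - a) * r - (b - h) * r  ≡⟨ identity a b h r ⟩
      (h - a) * r                ∎
      where
      open ≡-Reasoning
      identity : ∀ a b h r → (b - a) * r - (b - h) * r ≡ (h - a) * r
      identity = solve-∀ ℚ-ring

  crossing-pos : 0ℚ < crossing a b h
  crossing-pos = *-pos (p<q⇒0<q-p h<b) (proj₁ r-spec)

  crossing-≤1 : crossing a b h ≤ 1ℚ
  crossing-≤1 = ≤-by-difference ((h - a) * r) 1-t≡ (*-nonNeg (p≤q⇒0≤q-p a≤h) (<⇒≤ (proj₁ r-spec)))

  crossing-<1 : a < h → crossing a b h < 1ℚ
  crossing-<1 a<h = <-by-difference ((h - a) * r) 1-t≡ (*-pos (p<q⇒0<q-p a<h) (proj₁ r-spec))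

  crossing-level : crossing a b h * a + (1ℚ - crossing a b h) * b ≡ h
  crossing-level = begin
    t * a + (1ℚ - t) * b              ≡⟨ cong (λ s → t * a + s * b) 1-t≡ ⟩
    (b - h) * r * a + (h - a) * r * b ≡⟨ identity a b h r ⟩
    h * ((b - a) * r)                 ≡⟨ cong (h *_) (proj₂ r-spec) ⟩
    h * 1ℚ                            ≡⟨ *-identityʳ h ⟩
    h                                 ∎
    where
    open ≡-Reasoning
    identity : ∀ a b h r → (b - h) * r * a + (h - a) * r * b ≡ h * ((b - a) * r)
    identity = solve-∀ ℚ-ring

module _ (φ : Affine) (y z : Pt) {h : ℚ} (low : ⟦ φ ⟧ y ≤ h) (high : h < ⟦ φ ⟧ z) where

  crossing-point : Pt
  crossing-point = comb (crossing (⟦ φ ⟧ y) (⟦ φ ⟧ z) h) y z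

  crossing-point∈P : ∀ {P} → y ∈P P → z ∈P P → crossing-point ∈P P
  crossing-point∈P {P} = comb∈P {P} (<⇒≤ (crossing-pos low high)) (crossing-≤1 low high)

  crossing-point-level : ⟦ φ ⟧ crossing-point ≡ h
  crossing-point-level = trans (⟦⟧-comb φ (crossing (⟦ φ ⟧ y) (⟦ φ ⟧ z) h) y z) (crossing-level low high)

record CrossesAxesPositively (P : IntPolygon) (φ ψ : Affine) : Set where
  field
    axis₁-nonNeg : ∀ x → x ∈P P → ⟦ ψ ⟧ x ≡ 0ℚ → 0ℚ ≤ ⟦ φ ⟧ x
    axis₂-nonNeg : ∀ x → x ∈P P → ⟦ φ ⟧ x ≡ 0ℚ → 0ℚ ≤ ⟦ ψ ⟧ x
    origin∉P     : ∀ x → x ∈P P → ⟦ φ ⟧ x ≡ 0ℚ → ⟦ ψ ⟧ x ≡ 0ℚ → ⊥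
    φ<0 : ∃ λ x → x ∈P P × ⟦ φ ⟧ x < 0ℚ
    φ>0 : ∃ λ x → x ∈P P × 0ℚ < ⟦ φ ⟧ x
    ψ<0 : ∃ λ x → x ∈P P × ⟦ ψ ⟧ x < 0ℚ
    ψ>0 : ∃ λ x → x ∈P P × 0ℚ < ⟦ ψ ⟧ x

swap-axes : ∀ {P φ ψ} → CrossesAxesPositively P φ ψ → CrossesAxesPositively P ψ φ
swap-axes H = record
  { axis₁-nonNeg = axis₂-nonNeg
  ; axis₂-nonNeg = axis₁-nonNeg
  ; origin∉P     = λ x x∈P ψx≡0 φx≡0 → origin∉P x x∈P φx≡0 ψx≡0
  ; φ<0 = ψ<0 ; φ>0 = ψ>0 ; ψ<0 = φ<0 ; ψ>0 = φ>0
  }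
  where open CrossesAxesPositively H

module _ {P : IntPolygon} {φ ψ : Affine} (H : CrossesAxesPositively P φ ψ) where

  open CrossesAxesPositively H

  positive-on-axis₁ : ∀ {x} → x ∈P P → ⟦ ψ ⟧ x ≡ 0ℚ → 0ℚ < ⟦ φ ⟧ x
  positive-on-axis₁ {x} x∈P ψx≡0 =
    ≤∧≢⇒< (axis₁-nonNeg x x∈P ψx≡0) (λ 0≡φx → origin∉P x x∈P (sym 0≡φx) ψx≡0)

  positive-on-axis₂ : ∀ {x} → x ∈P P → ⟦ φ ⟧ x ≡ 0ℚ → 0ℚ < ⟦ ψ ⟧ x
  positive-on-axis₂ {x} x∈P φx≡0 =
    ≤∧≢⇒< (axis₂-nonNeg x x∈P φx≡0) (λ 0≡ψx → origin∉P x x∈P φx≡0 (sym 0≡ψx))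

  -- Walk from x towards a point above the φ-axis until ψ = 0, then back towards x until φ = 0:
  -- the point reached is on the ψ-axis below the origin.
  no-point-in-negative-quadrant : ∀ {x} → x ∈P P → ⟦ φ ⟧ x ≤ 0ℚ → ⟦ ψ ⟧ x ≤ 0ℚ → ⊥
  no-point-in-negative-quadrant {x} x∈P φx≤0 ψx≤0 with <-cmp (⟦ φ ⟧ x) 0ℚ
  ... | tri> _ _ 0<φx = <-irrefl refl (<-≤-trans 0<φx φx≤0)
  ... | tri≈ _ φx≡0 _ = <-irrefl refl (<-≤-trans (positive-on-axis₂ x∈P φx≡0) ψx≤0)
  ... | tri< φx<0 _ _ = <-irrefl refl (<-≤-trans (positive-on-axis₂ y∈P φy≡0) ψy≤0)
    where
    p = proj₁ ψ>0
    p∈P = proj₁ (proj₂ ψ>0)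
    0<ψp = proj₂ (proj₂ ψ>0)
    z = crossing-point ψ x p ψx≤0 0<ψp
    z∈P : z ∈P P
    z∈P = crossing-point∈P ψ x p ψx≤0 0<ψp {P} x∈P p∈P
    ψz≡0 : ⟦ ψ ⟧ z ≡ 0ℚ
    ψz≡0 = crossing-point-level ψ x p ψx≤0 0<ψp
    0<φz = positive-on-axis₁ z∈P ψz≡0
    s = crossing (⟦ φ ⟧ x) (⟦ φ ⟧ z) 0ℚ
    y = crossing-point φ x z φx≤0 0<φz
    y∈P : y ∈P P
    y∈P = crossing-point∈P φ x z φx≤0 0<φz {P} x∈P z∈P
    φy≡0 = crossing-point-level φ x z φx≤0 0<φz
    ψy≤0 : ⟦ ψ ⟧ y ≤ 0ℚ
    ψy≤0 = begin
      ⟦ ψ ⟧ y                          ≡⟨ ⟦⟧-comb ψ s x z ⟩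
      s * ⟦ ψ ⟧ x + (1ℚ - s) * ⟦ ψ ⟧ z ≡⟨ cong (λ c → s * ⟦ ψ ⟧ x + (1ℚ - s) * c) ψz≡0 ⟩
      s * ⟦ ψ ⟧ x + (1ℚ - s) * 0ℚ      ≡⟨ drop-zero s (⟦ ψ ⟧ x) ⟩
      s * ⟦ ψ ⟧ x                      ≤⟨ *-monoˡ-≤-nonNeg s {{nonNegative (<⇒≤ (crossing-pos φx≤0 0<φz))}} ψx≤0 ⟩
      s * 0ℚ                           ≡⟨ *-zeroʳ s ⟩
      0ℚ                               ∎
      where
      open ≤-Reasoning
      drop-zero : ∀ s a → s * a + (1ℚ - s) * 0ℚ ≡ s * a
      drop-zero = solve-∀ ℚ-ring

  φ-minimiser-signs : ∀ {A} → A ∈P P → (∀ x → x ∈P P → ⟦ φ ⟧ A ≤ ⟦ φ ⟧ x) → ⟦ φ ⟧ A < 0ℚ × 0ℚ < ⟦ ψ ⟧ A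
  φ-minimiser-signs A∈P A-min = φA<0 , ≰⇒> (no-point-in-negative-quadrant A∈P (<⇒≤ φA<0))
    where
    φA<0 = ≤-<-trans (A-min _ (proj₁ (proj₂ φ<0))) (proj₂ (proj₂ φ<0))

minimiser-of-positive-combination-is-Pareto :
  ∀ {P} φ ψ → cross (gradient φ) (gradient ψ) ≢ 0ℚ → ∀ {a b x} → 0ℚ < a → 0ℚ < b → x ∈P P →
  (∀ y → y ∈P P → a * ⟦ φ ⟧ x + b * ⟦ ψ ⟧ x ≤ a * ⟦ φ ⟧ y + b * ⟦ ψ ⟧ y) → Pareto P (gradient φ) (gradient ψ) x
minimiser-of-positive-combination-is-Pareto φ ψ D≢0 0<a 0<b x∈P x-min = x∈P , λ y y∈P ux≤uy vx≤vy →
  let φy≡φx , ψy≡ψx = positive-combination-≡ 0<a 0<b (⟦⟧-antitone φ ux≤uy) (⟦⟧-antitone ψ vx≤vy) (x-min y y∈P)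
  in dot-injective (gradient φ) (gradient ψ) D≢0 (⟦⟧-injective φ φy≡φx) (⟦⟧-injective ψ ψy≡ψx)

module SupportingEdge {P : IntPolygon} (φ ψ : Affine) {h : ℚ} (0<h : 0ℚ < h)
                      (gap : ∀ k → 0ℚ < ⟦ ψ ⟧ (gen P k) → h < ⟦ ψ ⟧ (gen P k)) where

  α β : Fin (m P) → ℚ
  α k = ⟦ φ ⟧ (gen P k)
  β k = ⟦ ψ ⟧ (gen P k)

  Straddles : Fin (m P) × Fin (m P) → Set
  Straddles (i , j) = β i ≤ 0ℚ × 0ℚ < β j

  straddles? : Decidable Straddles
  straddles? (i , j) = (β i ≤? 0ℚ) ×-dec (0ℚ <? β j)

  weight : Fin (m P) × Fin (m P) → ℚ
  weight (i , j) = crossing (β i) (β j) h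

  height : Fin (m P) × Fin (m P) → ℚ
  height (i , j) = ⟦ φ ⟧ (comb (weight (i , j)) (gen P i) (gen P j))

  module _ {i j} (st : Straddles (i , j)) where

    private
      βᵢ<h = ≤-<-trans (proj₁ st) 0<h
      βᵢ≤h = <⇒≤ βᵢ<h
      h<βⱼ = gap j (proj₂ st)

    weight-pos : 0ℚ < weight (i , j)
    weight-pos = crossing-pos βᵢ≤h h<βⱼ

    weight-<1 : weight (i , j) < 1ℚ
    weight-<1 = crossing-<1 βᵢ≤h h<βⱼ βᵢ<h

    at-height : ∀ d e → d * height (i , j) + e * h ≡
                weight (i , j) * (d * α i + e * β i) + (1ℚ - weight (i , j)) * (d * α j + e * β j)
    at-height d e =
      trans (cong (λ c → d * height (i , j) + e * c) (sym (crossing-point-level ψ (gen P i) (gen P j) βᵢ≤h h<βⱼ)))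
            (lincomb-comb d φ e ψ (weight (i , j)) (gen P i) (gen P j))

  edge-functional : Fin (m P) × Fin (m P) → Fin (m P) → ℚ
  edge-functional (i , j) k = (β j - β i) * α k + (α i - α j) * β k

  edge-functional-endpoints : ∀ i j → edge-functional (i , j) i ≡ edge-functional (i , j) j
  edge-functional-endpoints i j = same-value (α i) (α j) (β i) (β j)
    where
    same-value : ∀ a a' b b' → (b' - b) * a + (a - a') * b ≡ (b' - b) * a' + (a - a') * b'
    same-value = solve-∀ ℚ-ring

  -- A generator k below the supporting line would give an edge (k , j) or (i , k) crossing the
  -- level ψ = h lower than (i , j) does.
  module _ (i j : Fin (m P)) (st : Straddles (i , j)) (lowest : ∀ q → Straddles q → height (i , j) ≤ height q) where

    private
      d = β j - β i
      e = α i - α j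
      F = edge-functional (i , j)

      Fᵢ-at-height : d * height (i , j) + e * h ≡ F i
      Fᵢ-at-height = begin
        d * height (i , j) + e * h                         ≡⟨ at-height st d e ⟩
        weight (i , j) * F i + (1ℚ - weight (i , j)) * F j ≡⟨ cong (λ c → weight (i , j) * F i + (1ℚ - weight (i , j)) * c)
                                                                  (sym (edge-functional-endpoints i j)) ⟩
        weight (i , j) * F i + (1ℚ - weight (i , j)) * F i ≡⟨ mix-of-equal (weight (i , j)) (F i) ⟩
        F i                                                ∎
        where open ≡-Reasoning

      below : ∀ q → Straddles q → F i ≤ d * height q + e * h
      below q st-q = begin
        F i                         ≡⟨ sym Fᵢ-at-height ⟩
        d * height (i , j) + e * h  ≤⟨ +-monoˡ-≤ (e * h) (*-monoˡ-≤-nonNeg d {{nonNegative 0≤d}} (lowest q st-q)) ⟩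
        d * height q + e * h        ∎
        where
        open ≤-Reasoning
        0≤d = p≤q⇒0≤q-p (≤-trans (proj₁ st) (<⇒≤ (proj₂ st)))

      supports-by-side : ∀ k → Dec (β k ≤ 0ℚ) → F i ≤ F k
      supports-by-side k (yes βₖ≤0) = below-left-mix (weight-pos st-kj) (begin
          F i                                                ≤⟨ below (k , j) st-kj ⟩
          d * height (k , j) + e * h                         ≡⟨ at-height st-kj d e ⟩
          weight (k , j) * F k + (1ℚ - weight (k , j)) * F j ≡⟨ cong (λ c → weight (k , j) * F k + (1ℚ - weight (k , j)) * c)
                                                                    (sym (edge-functional-endpoints i j)) ⟩
          weight (k , j) * F k + (1ℚ - weight (k , j)) * F i ∎)
        where
        open ≤-Reasoning
        st-kj = βₖ≤0 , proj₂ st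
      supports-by-side k (no  βₖ≰0) = below-right-mix (weight-<1 st-ik) (begin
          F i                                                ≤⟨ below (i , k) st-ik ⟩
          d * height (i , k) + e * h                         ≡⟨ at-height st-ik d e ⟩
          weight (i , k) * F i + (1ℚ - weight (i , k)) * F k ∎)
        where
        open ≤-Reasoning
        st-ik = proj₁ st , ≰⇒> βₖ≰0

    lowest-crossing-supports : ∀ k → edge-functional (i , j) i ≤ edge-functional (i , j) k
    lowest-crossing-supports k = supports-by-side k (β k ≤? 0ℚ)

  supporting-edge : Σ _ Straddles → Σ (Fin (m P) × Fin (m P)) λ e →
                    Straddles e × (∀ k → edge-functional e (proj₁ e) ≤ edge-functional e k)
  supporting-edge p₀ = (i , j) , st , lowest-crossing-supports i j st (proj₂ (proj₂ best))
    where
    best = index-pair-minimiser straddles? height p₀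
    i = proj₁ (proj₁ best)
    j = proj₂ (proj₁ best)
    st = proj₁ (proj₂ best)

module ParetoPoint {P : IntPolygon} {φ ψ : Affine} (H : CrossesAxesPositively P φ ψ)
                   (D≢0 : cross (gradient φ) (gradient ψ) ≢ 0ℚ) where

  open CrossesAxesPositively H

  private
    x₀∈P = proj₁ (proj₂ φ<0)
    φ-least = minimising-generator P x₀∈P φ
    ψ-least = minimising-generator P x₀∈P ψ
    φ-least-signs = φ-minimiser-signs H (gen∈P P (proj₁ φ-least)) (proj₂ φ-least)
    ψ-least-signs = φ-minimiser-signs (swap-axes H) (gen∈P P (proj₁ ψ-least)) (proj₂ ψ-least)

  level : ∃ λ h → 0ℚ < h × (∀ k → 0ℚ < ⟦ ψ ⟧ (gen P k) → h < ⟦ ψ ⟧ (gen P k))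
  level = h , 0<h , λ k 0<ψₖ → <-≤-trans h<ψ* (proj₂ (proj₂ lowest-positive) k 0<ψₖ)
    where
    lowest-positive = index-minimiser (λ k → 0ℚ <? ⟦ ψ ⟧ (gen P k)) (λ k → ⟦ ψ ⟧ (gen P k))
                                      (proj₁ φ-least , proj₂ φ-least-signs)
    dense = <-dense (proj₁ (proj₂ lowest-positive))
    h = proj₁ dense
    0<h = proj₁ (proj₂ dense)
    h<ψ* = proj₂ (proj₂ dense)

  open SupportingEdge {P} φ ψ (proj₁ (proj₂ level)) (proj₂ (proj₂ level))

  private
    edge = supporting-edge ((proj₁ ψ-least , proj₁ φ-least) , <⇒≤ (proj₁ ψ-least-signs) , proj₂ φ-least-signs)
    i = proj₁ (proj₁ edge)
    j = proj₂ (proj₁ edge)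
    βᵢ≤0 = proj₁ (proj₁ (proj₂ edge))
    0<βⱼ = proj₂ (proj₁ (proj₂ edge))
    d = β j - β i
    e = α i - α j

    F : Pt → ℚ
    F y = d * ⟦ φ ⟧ y + e * ⟦ ψ ⟧ y

    F-constant-on-segment : ∀ t {y z} → F y ≡ F (gen P i) → F z ≡ F (gen P i) → F (comb t y z) ≡ F (gen P i)
    F-constant-on-segment t {y} {z} Fy≡Fᵢ Fz≡Fᵢ = trans (lincomb-comb d φ e ψ t y z)
      (trans (cong₂ (λ a b → t * a + (1ℚ - t) * b) Fy≡Fᵢ Fz≡Fᵢ) (mix-of-equal t (F (gen P i))))

    Fⱼ≡Fᵢ : F (gen P j) ≡ F (gen P i)
    Fⱼ≡Fᵢ = sym (edge-functional-endpoints i j)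

    F-least : ∀ y → y ∈P P → F (gen P i) ≤ F y
    F-least y y∈P = subst (F (gen P i) ≤_) (⟦lincomb⟧ d φ e ψ y)
      (⟦⟧-lower-bound-on-hull {P} y∈P (lincomb d φ e ψ)
        (λ k _ → subst (F (gen P i) ≤_) (sym (⟦lincomb⟧ d φ e ψ (gen P k))) (proj₂ (proj₂ edge) k)))

    0<d : 0ℚ < d
    0<d = p<q⇒0<q-p (≤-<-trans βᵢ≤0 0<βⱼ)

    -- Otherwise a point with φ < 0 (hence ψ > 0) would lie strictly below the supporting line.
    0<e : 0ℚ < e
    0<e = ≰⇒> (λ e≤0 → <-irrefl refl (<-≤-trans (F-drop e≤0) (F-least y₀ y₀∈P)))
      where
      y₀ = proj₁ φ<0
      y₀∈P = proj₁ (proj₂ φ<0)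
      φy₀<0 = proj₂ (proj₂ φ<0)
      0<ψy₀ = ≰⇒> (no-point-in-negative-quadrant H y₀∈P (<⇒≤ φy₀<0))
      0<αᵢ = ≰⇒> (λ αᵢ≤0 → no-point-in-negative-quadrant H (gen∈P P i) αᵢ≤0 βᵢ≤0)
      regroup : ∀ d e a b a' b' → (d * a + e * b) - (d * a' + e * b') ≡ d * (a - a') + (0ℚ - e) * (b' - b)
      regroup = solve-∀ ℚ-ring
      F-drop : e ≤ 0ℚ → F y₀ < F (gen P i)
      F-drop e≤0 = <-by-difference _ (regroup d e (α i) (β i) (⟦ φ ⟧ y₀) (⟦ ψ ⟧ y₀))
        (+-mono-<-≤ (*-pos 0<d (p<q⇒0<q-p (<-trans φy₀<0 0<αᵢ)))
                    (*-nonNeg (p≤q⇒0≤q-p e≤0) (p≤q⇒0≤q-p (≤-trans βᵢ≤0 (<⇒≤ 0<ψy₀)))))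

    Pareto-on-edge-line : ∀ {x} → x ∈P P → F x ≡ F (gen P i) → Pareto P (gradient φ) (gradient ψ) x
    Pareto-on-edge-line {x} x∈P Fx≡Fᵢ = minimiser-of-positive-combination-is-Pareto {P} φ ψ D≢0 {x = x} 0<d 0<e x∈P
      (λ y y∈P → subst (_≤ F y) (sym Fx≡Fᵢ) (F-least y y∈P))

    p₀ = crossing-point ψ (gen P i) (gen P j) βᵢ≤0 0<βⱼ
    p₀∈P = crossing-point∈P ψ (gen P i) (gen P j) βᵢ≤0 0<βⱼ {P} (gen∈P P i) (gen∈P P j)
    0<φp₀ = positive-on-axis₁ H p₀∈P (crossing-point-level ψ (gen P i) (gen P j) βᵢ≤0 0<βⱼ)

    Fp₀≡Fᵢ : F p₀ ≡ F (gen P i)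
    Fp₀≡Fᵢ = F-constant-on-segment (crossing (β i) (β j) 0ℚ) refl Fⱼ≡Fᵢ

    -- p₀ is on the φ-axis with φ > 0; move from it towards gen P j while keeping φ > 0
    pareto-point-inside : α j ≤ 0ℚ → ∃ λ x → Pareto P (gradient φ) (gradient ψ) x × 0ℚ < ⟦ φ ⟧ x × 0ℚ < ⟦ ψ ⟧ x
    pareto-point-inside αⱼ≤0 = x , Pareto-on-edge-line x∈P Fx≡Fᵢ , 0<φx , 0<ψx
      where
      dense = <-dense 0<φp₀
      c = proj₁ dense
      0<c = proj₁ (proj₂ dense)
      c<φp₀ = proj₂ (proj₂ dense)
      αⱼ≤c = ≤-trans αⱼ≤0 (<⇒≤ 0<c)
      t = crossing (α j) (⟦ φ ⟧ p₀) c
      x = crossing-point φ (gen P j) p₀ αⱼ≤c c<φp₀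
      x∈P = crossing-point∈P φ (gen P j) p₀ αⱼ≤c c<φp₀ {P} (gen∈P P j) p₀∈P
      0<φx = subst (0ℚ <_) (sym (crossing-point-level φ (gen P j) p₀ αⱼ≤c c<φp₀)) 0<c
      0<ψx : 0ℚ < ⟦ ψ ⟧ x
      0<ψx = subst (0ℚ <_) (sym ψx≡) (*-pos (crossing-pos αⱼ≤c c<φp₀) 0<βⱼ)
        where
        open ≡-Reasoning
        drop-zero : ∀ t b → t * b + (1ℚ - t) * 0ℚ ≡ t * b
        drop-zero = solve-∀ ℚ-ring
        ψx≡ : ⟦ ψ ⟧ x ≡ t * β j
        ψx≡ = begin
          ⟦ ψ ⟧ x                           ≡⟨ ⟦⟧-comb ψ t (gen P j) p₀ ⟩
          t * β j + (1ℚ - t) * ⟦ ψ ⟧ p₀     ≡⟨ cong (λ c → t * β j + (1ℚ - t) * c)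
                                                     (crossing-point-level ψ (gen P i) (gen P j) βᵢ≤0 0<βⱼ) ⟩
          t * β j + (1ℚ - t) * 0ℚ           ≡⟨ drop-zero t (β j) ⟩
          t * β j                           ∎
      Fx≡Fᵢ : F x ≡ F (gen P i)
      Fx≡Fᵢ = F-constant-on-segment t Fⱼ≡Fᵢ Fp₀≡Fᵢ

    pareto-point-by-sign : Dec (0ℚ < α j) → ∃ λ x → Pareto P (gradient φ) (gradient ψ) x × 0ℚ < ⟦ φ ⟧ x × 0ℚ < ⟦ ψ ⟧ x
    pareto-point-by-sign (yes 0<αⱼ) =
      gen P j , Pareto-on-edge-line (gen∈P P j) Fⱼ≡Fᵢ , 0<αⱼ , 0<βⱼ
    pareto-point-by-sign (no  0≮αⱼ) = pareto-point-inside (≮⇒≥ 0≮αⱼ)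

  pareto-point : ∃ λ x → Pareto P (gradient φ) (gradient ψ) x × 0ℚ < ⟦ φ ⟧ x × 0ℚ < ⟦ ψ ⟧ x
  pareto-point = pareto-point-by-sign (0ℚ <? α j)

FrameSplits-swap : ∀ {o f₁ f₂ A B Q} → FrameSplits o f₁ f₂ A B Q → FrameSplits o f₁ f₂ B A Q
FrameSplits-swap (ends , inside) = Sum.swap ends , inside

frame-splits-Pareto-arc :
  ∀ {P} o f₁ f₂ {φ ψ} → (∀ x → coord₁ o f₁ f₂ x ≡ ⟦ φ ⟧ x) → (∀ x → coord₂ o f₁ f₂ x ≡ ⟦ ψ ⟧ x) →
  cross (gradient φ) (gradient ψ) ≢ 0ℚ → CrossesAxesPositively P φ ψ →
  ∀ A B → Maximiser P (gradient φ) A → Maximiser P (gradient ψ) B →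
  FrameSplits o f₁ f₂ A B (Pareto P (gradient φ) (gradient ψ))
frame-splits-Pareto-arc o f₁ f₂ {φ} {ψ} coord₁≡ coord₂≡ D≢0 H A B (A∈P , A-max) (B∈P , B-max) =
  inj₁ (as-coord₁ _<_ (proj₁ A-signs) , as-coord₂ (flip _<_) (proj₂ A-signs) ,
        as-coord₁ (flip _<_) (proj₂ B-signs) , as-coord₂ _<_ (proj₁ B-signs)) ,
  x , x-Pareto , as-coord₁ (flip _<_) 0<φx , as-coord₂ (flip _<_) 0<ψx
  where
  as-coord₁ : ∀ (R : ℚ → ℚ → Set) {y} → R (⟦ φ ⟧ y) 0ℚ → R (coord₁ o f₁ f₂ y) 0ℚ
  as-coord₁ R {y} = subst (λ c → R c 0ℚ) (sym (coord₁≡ y))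
  as-coord₂ : ∀ (R : ℚ → ℚ → Set) {y} → R (⟦ ψ ⟧ y) 0ℚ → R (coord₂ o f₁ f₂ y) 0ℚ
  as-coord₂ R {y} = subst (λ c → R c 0ℚ) (sym (coord₂≡ y))
  A-signs = φ-minimiser-signs H A∈P (λ x x∈P → ⟦⟧-antitone φ (A-max x x∈P))
  B-signs = φ-minimiser-signs (swap-axes H) B∈P (λ x x∈P → ⟦⟧-antitone ψ (B-max x x∈P))
  open ParetoPoint H D≢0 using (pareto-point)
  x = proj₁ pareto-point
  x-Pareto = proj₁ (proj₂ pareto-point)
  0<φx = proj₁ (proj₂ (proj₂ pareto-point))
  0<ψx = proj₂ (proj₂ (proj₂ pareto-point))

LineSplits : IntPolygon → (across along : Pt → ℚ) → ℚ → ℚ → Set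
LineSplits P across along c N =
    (∀ x → x ∈P P → across x ≡ c → 0ℚ ≤ along x × along x ≤ N)
  × (∃ λ x → x ∈P P × across x < c)
  × (∃ λ x → x ∈P P × c < across x)

module _ {P : IntPolygon} {N : ℚ} (0<N : 0ℚ < N) where

  private
    SignedSplit : (σ τ : Pt → ℚ) → Set
    SignedSplit σ τ = (∀ x → x ∈P P → σ x ≡ 0ℚ → 0ℚ ≤ τ x × τ x ≤ N)
                      × (∃ λ x → x ∈P P × σ x < 0ℚ) × (∃ λ x → x ∈P P × 0ℚ < σ x)

    segment-splits-signed : ∀ {a b} (σ τ : Pt → ℚ) →
      (∀ x → cross (b ⊖ a) (x ⊖ a) ≡ N * σ x) → (∀ x → dot (x ⊖ a) (b ⊖ a) ≡ N * τ x) →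
      dot (b ⊖ a) (b ⊖ a) ≡ N * N → SegmentSplits a b P → SignedSplit σ τ
    segment-splits-signed σ τ cross≡ dot≡ length² (on-line , (p , p∈P , 0<cross) , (q , q∈P , cross<0)) =
      bounds ,
      (q , q∈P , neg-factor 0<N (subst (_< 0ℚ) (cross≡ q) cross<0)) ,
      (p , p∈P , pos-factor 0<N (subst (0ℚ <_) (cross≡ p) 0<cross))
      where
      bounds : ∀ x → x ∈P P → σ x ≡ 0ℚ → 0ℚ ≤ τ x × τ x ≤ N
      bounds x x∈P σx≡0 with on-line x x∈P (trans (cross≡ x) (trans (cong (N *_) σx≡0) (*-zeroʳ N)))
      ... | _ , lo , hi = nonNeg-factor 0<N (subst (0ℚ ≤_) (dot≡ x) lo) ,
                          *-cancelˡ-≤-pos N {{positive 0<N}} (subst₂ _≤_ (dot≡ x) length² hi)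

    horizontal-cross : ∀ N c x₁ x₂ → (N - 0ℚ) * (x₂ - c) - (c - c) * (x₁ - 0ℚ) ≡ N * (x₂ - c)
    horizontal-cross = solve-∀ ℚ-ring
    horizontal-dot : ∀ N c x₁ x₂ → (x₁ - 0ℚ) * (N - 0ℚ) + (x₂ - c) * (c - c) ≡ N * x₁
    horizontal-dot = solve-∀ ℚ-ring
    horizontal-length : ∀ N c → (N - 0ℚ) * (N - 0ℚ) + (c - c) * (c - c) ≡ N * N
    horizontal-length = solve-∀ ℚ-ring

    vertical-cross : ∀ N c x₁ x₂ → (c - c) * (x₂ - 0ℚ) - (N - 0ℚ) * (x₁ - c) ≡ N * (c - x₁)
    vertical-cross = solve-∀ ℚ-ring
    vertical-dot : ∀ N c x₁ x₂ → (x₁ - c) * (c - c) + (x₂ - 0ℚ) * (N - 0ℚ) ≡ N * x₂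
    vertical-dot = solve-∀ ℚ-ring
    vertical-length : ∀ N c → (c - c) * (c - c) + (N - 0ℚ) * (N - 0ℚ) ≡ N * N
    vertical-length = solve-∀ ℚ-ring

  horizontal-segment-splits : ∀ c → SegmentSplits (0ℚ , c) (N , c) P → LineSplits P proj₂ proj₁ c N
  horizontal-segment-splits c splits = from-signed (segment-splits-signed {0ℚ , c} {N , c} (λ x → proj₂ x - c) proj₁
    (λ (x₁ , x₂) → horizontal-cross N c x₁ x₂) (λ (x₁ , x₂) → horizontal-dot N c x₁ x₂) (horizontal-length N c) splits)
    where
    from-signed : SignedSplit (λ x → proj₂ x - c) proj₁ → LineSplits P proj₂ proj₁ c N
    from-signed (bounds , (q , q∈P , q₂-c<0) , (p , p∈P , 0<p₂-c)) =
      (λ x x∈P x₂≡c → bounds x x∈P (trans (cong (_- c) x₂≡c) (+-inverseʳ c))) ,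
      (q , q∈P , p-q<0⇒p<q q₂-c<0) , (p , p∈P , <-by-difference _ refl 0<p₂-c)

  vertical-segment-splits : ∀ c → SegmentSplits (c , 0ℚ) (c , N) P → LineSplits P proj₁ proj₂ c N
  vertical-segment-splits c splits = from-signed (segment-splits-signed {c , 0ℚ} {c , N} (λ x → c - proj₁ x) proj₂
    (λ (x₁ , x₂) → vertical-cross N c x₁ x₂) (λ (x₁ , x₂) → vertical-dot N c x₁ x₂) (vertical-length N c) splits)
    where
    from-signed : SignedSplit (λ x → c - proj₁ x) proj₂ → LineSplits P proj₁ proj₂ c N
    from-signed (bounds , (q , q∈P , c-q₁<0) , (p , p∈P , 0<c-p₁)) =
      (λ x x∈P x₁≡c → bounds x x∈P (trans (cong (λ y → c - y) x₁≡c) (+-inverseʳ c))) ,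
      (p , p∈P , <-by-difference _ refl 0<c-p₁) , (q , q∈P , p-q<0⇒p<q c-q₁<0)

lex-extreme-exists : ∀ P {x} → x ∈P P → ∀ u v → ∃ (LexExtreme P u v)
lex-extreme-exists P x∈P u v = gen P i , gen∈P P i , u-max , v-max-on-face
  where
  φᵤ φᵥ : Affine
  φᵤ = affine 0ℚ u
  φᵥ = affine 0ℚ v
  u-least = minimising-generator P x∈P φᵤ
  M = ⟦ φᵤ ⟧ (gen P (proj₁ u-least))
  best = index-minimiser (λ k → ⟦ φᵤ ⟧ (gen P k) ≟ M) (λ k → ⟦ φᵥ ⟧ (gen P k)) (proj₁ u-least , refl)
  i = proj₁ best
  i-on-top = proj₁ (proj₂ best)
  i-v-least = proj₂ (proj₂ best)
  u-max : ∀ y → y ∈P P → dot u y ≤ dot u (gen P i)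
  u-max y y∈P = ⟦⟧-antitone⁻¹ φᵤ (subst (_≤ ⟦ φᵤ ⟧ y) (sym i-on-top) (proj₂ u-least y y∈P))
  v-max-on-face : ∀ y → y ∈P P → dot u y ≡ dot u (gen P i) → dot v y ≤ dot v (gen P i)
  v-max-on-face y y∈P uy≡ui = ⟦⟧-antitone⁻¹ φᵥ (⟦⟧-lower-bound-on-hull {P} y∈P φᵥ λ k 0<wₖ →
    i-v-least k (⟦⟧-face {P} y∈P φᵤ (λ k → proj₂ u-least (gen P k) (gen∈P P k)) y-on-top k 0<wₖ))
    where
    y-on-top : ⟦ φᵤ ⟧ y ≡ M
    y-on-top = trans (cong (λ d → 0ℚ - d) uy≡ui) i-on-top

squeeze : ∀ {a b c t} → a ≤ c → b ≤ c → c ≡ t * a + (1ℚ - t) * b → 0ℚ < t → t < 1ℚ → a ≡ c × b ≡ c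
squeeze {a} {b} {c} {t} a≤c b≤c c≡ 0<t t<1 =
  positive-combination-≡ 0<t (p<q⇒0<q-p t<1) a≤c b≤c (≤-reflexive (trans (mix-of-equal t c) c≡))

lex-extreme-is-vertex : ∀ {P} u v {p} → cross u v ≢ 0ℚ → LexExtreme P u v p → IsVertex P p
lex-extreme-is-vertex u v D≢0 (p∈P , u-max , v-max-on-face) = p∈P , λ y z t y∈P z∈P 0<t t<1 p≡ →
  let uy≡up , uz≡up = squeeze (u-max y y∈P) (u-max z z∈P) (trans (cong (dot u) p≡) (dot-comb u t y z)) 0<t t<1
      vy≡vp , vz≡vp = squeeze (v-max-on-face y y∈P uy≡up) (v-max-on-face z z∈P uz≡up)
                              (trans (cong (dot v) p≡) (dot-comb v t y z)) 0<t t<1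
  in dot-injective u v D≢0 (trans uy≡up (sym uz≡up)) (trans vy≡vp (sym vz≡vp))

crossℤ : ℤ² → ℤ² → ℤ
crossℤ (a , b) (c , d) = a *ℤ d ℤ.- b *ℤ c

det∣crossℤ : ∀ A k l → detM A ∣ crossℤ (matApply A k) (matApply A l)
det∣crossℤ (mat a b c d) (k₁ , k₂) (l₁ , l₂) = divides (k₁ *ℤ l₂ ℤ.- k₂ *ℤ l₁) (identity a b c d k₁ k₂ l₁ l₂)
  where
  identity : ∀ a b c d k₁ k₂ l₁ l₂ →
    (a *ℤ k₁ ℤ.+ b *ℤ k₂) *ℤ (c *ℤ l₁ ℤ.+ d *ℤ l₂) ℤ.- (c *ℤ k₁ ℤ.+ d *ℤ k₂) *ℤ (a *ℤ l₁ ℤ.+ b *ℤ l₂)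
      ≡ (k₁ *ℤ l₂ ℤ.- k₂ *ℤ l₁) *ℤ (a *ℤ d ℤ.- b *ℤ c)
  identity = ℤ-Ring.solve-∀

e₁∈Γ⇒det∣x₂ : ∀ A {x} → (+ 1 , + 0) ∈Γ A → x ∈Γ A → detM A ∣ proj₂ x
e₁∈Γ⇒det∣x₂ A {x₁ , x₂} (k , Ak≡e₁) (l , Al≡x) =
  subst (detM A ∣_) (cross-e₁ x₁ x₂) (subst₂ (λ e y → detM A ∣ crossℤ e y) Ak≡e₁ Al≡x (det∣crossℤ A k l))
  where
  cross-e₁ : ∀ x₁ x₂ → + 1 *ℤ x₂ ℤ.- + 0 *ℤ x₁ ≡ x₂
  cross-e₁ = ℤ-Ring.solve-∀

e₂∈Γ⇒det∣x₁ : ∀ A {x} → (+ 0 , + 1) ∈Γ A → x ∈Γ A → detM A ∣ proj₁ x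
e₂∈Γ⇒det∣x₁ A {x₁ , x₂} (k , Ak≡e₂) (l , Al≡x) =
  subst (detM A ∣_) (cross-e₂ x₁ x₂) (subst₂ (λ y e → detM A ∣ crossℤ y e) Al≡x Ak≡e₂ (det∣crossℤ A l k))
  where
  cross-e₂ : ∀ x₁ x₂ → x₁ *ℤ + 1 ℤ.- x₂ *ℤ + 0 ≡ x₁
  cross-e₂ = ℤ-Ring.solve-∀

no-multiple-strictly-between : ∀ {d z n} → ℤ.∣ d ∣ ≡ n → d ∣ z → + 0 ℤ.< z → z ℤ.< + n → ⊥
no-multiple-strictly-between {z = + zero}  _ _ (ℤ.+<+ ()) _
no-multiple-strictly-between {z = + suc m} |d|≡n d∣z _ z<n =
  ℕ.<-irrefl refl (ℕ.<-≤-trans (ℤ.drop‿+<+ z<n) (subst (ℕ._≤ suc m) |d|≡n (ℕ.∣⇒≤ (∣⇒∣ᵤ d∣z))))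

gcd[i,1]≡1 : ∀ i → gcdℤ i (+ 1) ≡ + 1
gcd[i,1]≡1 i = cong +_ (ℕ.gcd-zeroʳ ℤ.∣ i ∣)

↥-toℚ : ∀ i → ↥ (toℚ i) ≡ i
↥-toℚ i = trans (sym (ℤ.*-identityʳ _)) (trans (cong (↥ (toℚ i) *ℤ_) (sym (gcd[i,1]≡1 i))) (↥-/ i 1))

↧-toℚ : ∀ i → ↧ (toℚ i) ≡ + 1
↧-toℚ i = trans (sym (ℤ.*-identityʳ _)) (trans (cong (↧ (toℚ i) *ℤ_) (sym (gcd[i,1]≡1 i))) (↧-/ i 1))

toℚ-cancel-< : ∀ {i j} → toℚ i < toℚ j → i ℤ.< j
toℚ-cancel-< {i} {j} i<j = subst₂ ℤ._<_ (numerator i j) (numerator j i) (drop-*<* i<j)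
  where
  numerator : ∀ a b → ↥ (toℚ a) *ℤ ↧ (toℚ b) ≡ a
  numerator a b = trans (cong₂ _*ℤ_ (↥-toℚ a) (↧-toℚ b)) (ℤ.*-identityʳ a)

module _ {n : ℕ} (A : Mat) (|det|≡n : ℤ.∣ detM A ∣ ≡ n) where

  large-step₁-≥2 : ∀ {x} → x ∈Γℚ A → 0ℚ < proj₂ x → proj₂ x < toℚ (+ n) → ∀ s → IsLargeStep₁ A s → 2 ℕ.≤ s
  large-step₁-≥2 _ _ _ zero (() , _)
  large-step₁-≥2 (k , Ak≡x) 0<x₂ x₂<n (suc zero) (_ , e₁∈Γ , _) = ⊥-elim (no-multiple-strictly-between |det|≡n
    (e₁∈Γ⇒det∣x₂ A e₁∈Γ (k , refl))
    (toℚ-cancel-< (subst (0ℚ <_) (sym (cong proj₂ Ak≡x)) 0<x₂))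
    (toℚ-cancel-< (subst (_< toℚ (+ n)) (sym (cong proj₂ Ak≡x)) x₂<n)))
  large-step₁-≥2 _ _ _ (suc (suc _)) _ = s≤s (s≤s z≤n)

  large-step₂-≥2 : ∀ {x} → x ∈Γℚ A → 0ℚ < proj₁ x → proj₁ x < toℚ (+ n) → ∀ s → IsLargeStep₂ A s → 2 ℕ.≤ s
  large-step₂-≥2 _ _ _ zero (() , _)
  large-step₂-≥2 (k , Ak≡x) 0<x₁ x₁<n (suc zero) (_ , e₂∈Γ , _) = ⊥-elim (no-multiple-strictly-between |det|≡n
    (e₂∈Γ⇒det∣x₁ A e₂∈Γ (k , refl))
    (toℚ-cancel-< (subst (0ℚ <_) (sym (cong proj₁ Ak≡x)) 0<x₁))
    (toℚ-cancel-< (subst (_< toℚ (+ n)) (sym (cong proj₁ Ak≡x)) x₁<n)))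
  large-step₂-≥2 _ _ _ (suc (suc _)) _ = s≤s (s≤s z≤n)

data Side : Set where
  low high : Side

module Square (n : ℕ) where

  N : ℚ
  N = toℚ (+ n)

  edge : Side → ℤ
  edge low  = + 0
  edge high = + n

  level : Side → ℚ
  level k = toℚ (edge k)

  edge-factor : Side → ℤ
  edge-factor low  = + 0
  edge-factor high = + 1

  edge-as-multiple : ∀ k → + n *ℤ edge-factor k ≡ edge k
  edge-as-multiple low  = ℤ.*-zeroʳ (+ n)
  edge-as-multiple high = ℤ.*-identityʳ (+ n)

  0<N : 0 ℕ.< n → 0ℚ < N
  0<N (s≤s _) = positive⁻¹ N {{normalize-pos n 1}}

  inward : Side → ℤ
  inward low  = + 1
  inward high = -[1+ 0 ]

  outward₁ outward₂ : Side → Pt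
  outward₁ low  = -e₁
  outward₁ high = e₁
  outward₂ low  = -e₂
  outward₂ high = e₂

  depth : Side → ℚ → ℚ
  depth low  t = t
  depth high t = N - t

  frame₁ frame₂ : Side → Affine
  frame₁ k = affine (level k) (outward₁ k)
  frame₂ k = affine (level k) (outward₂ k)

  ⟦frame₁⟧ : ∀ k x → ⟦ frame₁ k ⟧ x ≡ depth k (proj₁ x)
  ⟦frame₁⟧ low  (x₁ , x₂) = identity x₁ x₂
    where
    identity : ∀ x₁ x₂ → 0ℚ - ((- 1ℚ) * x₁ + 0ℚ * x₂) ≡ x₁
    identity = solve-∀ ℚ-ring
  ⟦frame₁⟧ high (x₁ , x₂) = identity N x₁ x₂
    where
    identity : ∀ N x₁ x₂ → N - (1ℚ * x₁ + 0ℚ * x₂) ≡ N - x₁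
    identity = solve-∀ ℚ-ring

  ⟦frame₂⟧ : ∀ k x → ⟦ frame₂ k ⟧ x ≡ depth k (proj₂ x)
  ⟦frame₂⟧ low  (x₁ , x₂) = identity x₁ x₂
    where
    identity : ∀ x₁ x₂ → 0ℚ - (0ℚ * x₁ + (- 1ℚ) * x₂) ≡ x₂
    identity = solve-∀ ℚ-ring
  ⟦frame₂⟧ high (x₁ , x₂) = identity N x₁ x₂
    where
    identity : ∀ N x₁ x₂ → N - (0ℚ * x₁ + 1ℚ * x₂) ≡ N - x₂
    identity = solve-∀ ℚ-ring

  inward-depth : ∀ k t → toℚ (inward k) * (t - level k) ≡ depth k t
  inward-depth low  t = identity t
    where
    identity : ∀ t → 1ℚ * (t - 0ℚ) ≡ t
    identity = solve-∀ ℚ-ring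
  inward-depth high t = identity N t
    where
    identity : ∀ N t → (- 1ℚ) * (t - N) ≡ N - t
    identity = solve-∀ ℚ-ring

  inward² : ∀ k → toℚ (inward k) * toℚ (inward k) ≡ 1ℚ
  inward² low  = refl
  inward² high = refl

  coord₁-corner : ∀ k₁ k₂ x → coord₁ (edge k₁ , edge k₂) (inward k₁ , + 0) (+ 0 , inward k₂) x ≡ depth k₁ (proj₁ x)
  coord₁-corner k₁ k₂ (x₁ , x₂) = begin
    ((x₁ - level k₁) * σ₂ - (x₂ - level k₂) * 0ℚ) * (σ₁ * σ₂ - 0ℚ * 0ℚ) ≡⟨ identity σ₁ σ₂ (level k₁) (level k₂) x₁ x₂ ⟩
    (σ₂ * σ₂) * (σ₁ * (x₁ - level k₁))                                 ≡⟨ cong (_* (σ₁ * (x₁ - level k₁))) (inward² k₂) ⟩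
    1ℚ * (σ₁ * (x₁ - level k₁))                                        ≡⟨ *-identityˡ _ ⟩
    σ₁ * (x₁ - level k₁)                                               ≡⟨ inward-depth k₁ x₁ ⟩
    depth k₁ x₁                                                        ∎
    where
    open ≡-Reasoning
    σ₁ = toℚ (inward k₁)
    σ₂ = toℚ (inward k₂)
    identity : ∀ σ₁ σ₂ E₁ E₂ x₁ x₂ →
               ((x₁ - E₁) * σ₂ - (x₂ - E₂) * 0ℚ) * (σ₁ * σ₂ - 0ℚ * 0ℚ) ≡ (σ₂ * σ₂) * (σ₁ * (x₁ - E₁))
    identity = solve-∀ ℚ-ring

  coord₂-corner : ∀ k₁ k₂ x → coord₂ (edge k₁ , edge k₂) (inward k₁ , + 0) (+ 0 , inward k₂) x ≡ depth k₂ (proj₂ x)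
  coord₂-corner k₁ k₂ (x₁ , x₂) = begin
    (σ₁ * (x₂ - level k₂) - 0ℚ * (x₁ - level k₁)) * (σ₁ * σ₂ - 0ℚ * 0ℚ) ≡⟨ identity σ₁ σ₂ (level k₁) (level k₂) x₁ x₂ ⟩
    (σ₁ * σ₁) * (σ₂ * (x₂ - level k₂))                                 ≡⟨ cong (_* (σ₂ * (x₂ - level k₂))) (inward² k₁) ⟩
    1ℚ * (σ₂ * (x₂ - level k₂))                                        ≡⟨ *-identityˡ _ ⟩
    σ₂ * (x₂ - level k₂)                                               ≡⟨ inward-depth k₂ x₂ ⟩
    depth k₂ x₂                                                        ∎
    where
    open ≡-Reasoning
    σ₁ = toℚ (inward k₁)
    σ₂ = toℚ (inward k₂)
    identity : ∀ σ₁ σ₂ E₁ E₂ x₁ x₂ →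
               (σ₁ * (x₂ - E₂) - 0ℚ * (x₁ - E₁)) * (σ₁ * σ₂ - 0ℚ * 0ℚ) ≡ (σ₁ * σ₁) * (σ₂ * (x₂ - E₂))
    identity = solve-∀ ℚ-ring

  outward-independent : ∀ k₁ k₂ → cross (outward₁ k₁) (outward₂ k₂) ≢ 0ℚ
  outward-independent low  low  ()
  outward-independent low  high ()
  outward-independent high low  ()
  outward-independent high high ()

  depth-zero : ∀ k {t} → depth k t ≡ 0ℚ → t ≡ level k
  depth-zero low  t≡0   = t≡0
  depth-zero high N-t≡0 = sym (p-q≡0⇒p≡q N-t≡0)

  depth-nonNeg : ∀ k {t} → 0ℚ ≤ t → t ≤ N → 0ℚ ≤ depth k t
  depth-nonNeg low  0≤t _   = 0≤t
  depth-nonNeg high _   t≤N = p≤q⇒0≤q-p t≤N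

  module _ {P : IntPolygon} {f : Pt → ℚ} where

    depth-neg : ∀ k → (∃ λ x → x ∈P P × f x < level k) × (∃ λ x → x ∈P P × level k < f x) →
                ∃ λ x → x ∈P P × depth k (f x) < 0ℚ
    depth-neg low  (below , _)               = below
    depth-neg high (_ , (x , x∈P , N<fx))    = x , x∈P , p<q⇒p-q<0 N<fx

    depth-pos : ∀ k → (∃ λ x → x ∈P P × f x < level k) × (∃ λ x → x ∈P P × level k < f x) →
                ∃ λ x → x ∈P P × 0ℚ < depth k (f x)
    depth-pos low  (_ , above)               = above
    depth-pos high ((x , x∈P , fx<N) , _)    = x , x∈P , p<q⇒0<q-p fx<N

  module Splitting {P : IntPolygon} (0<n : 0 ℕ.< n)
    (no-multiple-of-n : ∀ k₁ k₂ → ¬ (toPt (+ n *ℤ k₁ , + n *ℤ k₂) ∈P P))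
    (bottom : SegmentSplits (toPt (+ 0 , + 0)) (toPt (+ n , + 0)) P)
    (right  : SegmentSplits (toPt (+ n , + 0)) (toPt (+ n , + n)) P)
    (top    : SegmentSplits (toPt (+ 0 , + n)) (toPt (+ n , + n)) P)
    (left   : SegmentSplits (toPt (+ 0 , + 0)) (toPt (+ 0 , + n)) P) where

    vertical : ∀ k → LineSplits P proj₁ proj₂ (level k) N
    vertical low  = vertical-segment-splits {P} (0<N 0<n) (level low) left
    vertical high = vertical-segment-splits {P} (0<N 0<n) (level high) right

    horizontal : ∀ k → LineSplits P proj₂ proj₁ (level k) N
    horizontal low  = horizontal-segment-splits {P} (0<N 0<n) (level low) bottom
    horizontal high = horizontal-segment-splits {P} (0<N 0<n) (level high) top

    corner∉P : ∀ k₁ k₂ → ¬ ((level k₁ , level k₂) ∈P P)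
    corner∉P k₁ k₂ = subst (λ c → ¬ (toPt c ∈P P)) (cong₂ _,_ (edge-as-multiple k₁) (edge-as-multiple k₂))
                           (no-multiple-of-n (edge-factor k₁) (edge-factor k₂))

    module Corner (k₁ k₂ : Side) where

      private
        as-frame₁ : ∀ {R : Pt → ℚ → Set} → (∃ λ x → x ∈P P × R x (depth k₁ (proj₁ x))) →
                    ∃ λ x → x ∈P P × R x (⟦ frame₁ k₁ ⟧ x)
        as-frame₁ {R} (x , x∈P , r) = x , x∈P , subst (R x) (sym (⟦frame₁⟧ k₁ x)) r
        as-frame₂ : ∀ {R : Pt → ℚ → Set} → (∃ λ x → x ∈P P × R x (depth k₂ (proj₂ x))) →
                    ∃ λ x → x ∈P P × R x (⟦ frame₂ k₂ ⟧ x)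
        as-frame₂ {R} (x , x∈P , r) = x , x∈P , subst (R x) (sym (⟦frame₂⟧ k₂ x)) r
        on-line₁ : ∀ x → x ∈P P → ⟦ frame₁ k₁ ⟧ x ≡ 0ℚ → proj₁ x ≡ level k₁
        on-line₁ x x∈P φx≡0 = depth-zero k₁ (trans (sym (⟦frame₁⟧ k₁ x)) φx≡0)
        on-line₂ : ∀ x → x ∈P P → ⟦ frame₂ k₂ ⟧ x ≡ 0ℚ → proj₂ x ≡ level k₂
        on-line₂ x x∈P ψx≡0 = depth-zero k₂ (trans (sym (⟦frame₂⟧ k₂ x)) ψx≡0)

      crosses : CrossesAxesPositively P (frame₁ k₁) (frame₂ k₂)
      crosses = record
        { axis₁-nonNeg = λ x x∈P ψx≡0 → subst (0ℚ ≤_) (sym (⟦frame₁⟧ k₁ x))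
                           (uncurry (depth-nonNeg k₁) (proj₁ (horizontal k₂) x x∈P (on-line₂ x x∈P ψx≡0)))
        ; axis₂-nonNeg = λ x x∈P φx≡0 → subst (0ℚ ≤_) (sym (⟦frame₂⟧ k₂ x))
                           (uncurry (depth-nonNeg k₂) (proj₁ (vertical k₁) x x∈P (on-line₁ x x∈P φx≡0)))
        ; origin∉P     = λ x x∈P φx≡0 ψx≡0 →
                           corner∉P k₁ k₂ (subst (_∈P P) (cong₂ _,_ (on-line₁ x x∈P φx≡0) (on-line₂ x x∈P ψx≡0)) x∈P)
        ; φ<0 = as-frame₁ {λ _ c → c < 0ℚ} (depth-neg {P} {proj₁} k₁ (proj₂ (vertical k₁)))
        ; φ>0 = as-frame₁ {λ _ c → 0ℚ < c} (depth-pos {P} {proj₁} k₁ (proj₂ (vertical k₁)))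
        ; ψ<0 = as-frame₂ {λ _ c → c < 0ℚ} (depth-neg {P} {proj₂} k₂ (proj₂ (horizontal k₂)))
        ; ψ>0 = as-frame₂ {λ _ c → 0ℚ < c} (depth-pos {P} {proj₂} k₂ (proj₂ (horizontal k₂)))
        }

      frame-splits : ∀ A B → Maximiser P (outward₁ k₁) A → Maximiser P (outward₂ k₂) B →
        FrameSplits (edge k₁ , edge k₂) (inward k₁ , + 0) (+ 0 , inward k₂) A B (Pareto P (outward₁ k₁) (outward₂ k₂))
      frame-splits A B =
        frame-splits-Pareto-arc (edge k₁ , edge k₂) (inward k₁ , + 0) (+ 0 , inward k₂)
          (λ x → trans (coord₁-corner k₁ k₂ x) (sym (⟦frame₁⟧ k₁ x)))
          (λ x → trans (coord₂-corner k₁ k₂ x) (sym (⟦frame₂⟧ k₂ x)))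
          (outward-independent k₁ k₂) crosses A B

      frame-splits-swapped : ∀ A B → Maximiser P (outward₂ k₂) A → Maximiser P (outward₁ k₁) B →
        FrameSplits (edge k₁ , edge k₂) (inward k₁ , + 0) (+ 0 , inward k₂) A B (Pareto P (outward₁ k₁) (outward₂ k₂))
      frame-splits-swapped A B A-max B-max =
        FrameSplits-swap {edge k₁ , edge k₂} {inward k₁ , + 0} {+ 0 , inward k₂} {B} {A} (frame-splits B A B-max A-max)

      outward₁-maximiser-depth : ∀ A → Maximiser P (outward₁ k₁) A → 0ℚ < depth k₂ (proj₂ A)
      outward₁-maximiser-depth A (A∈P , A-max) = subst (0ℚ <_) (⟦frame₂⟧ k₂ A)
        (proj₂ (φ-minimiser-signs crosses A∈P (λ x x∈P → ⟦⟧-antitone (frame₁ k₁) (A-max x x∈P))))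

      outward₂-maximiser-depth : ∀ B → Maximiser P (outward₂ k₂) B → 0ℚ < depth k₁ (proj₁ B)
      outward₂-maximiser-depth B (B∈P , B-max) = subst (0ℚ <_) (⟦frame₁⟧ k₁ B)
        (proj₂ (φ-minimiser-signs (swap-axes crosses) B∈P (λ x x∈P → ⟦⟧-antitone (frame₂ k₂) (B-max x x∈P))))

    large-steps-≥2 : (Γ : Mat) → Is1nLattice n Γ → (∀ x → IsVertex P x → x ∈Γℚ Γ) →
                     (∀ s → IsLargeStep₁ Γ s → 2 ℕ.≤ s) × (∀ s → IsLargeStep₂ Γ s → 2 ℕ.≤ s)
    large-steps-≥2 Γ (_ , |det|≡n) vertices∈Γ =
      large-step₁-≥2 Γ |det|≡n (vertices∈Γ W (lex-extreme-is-vertex {P} -e₁ -e₂ (λ ()) W-lex))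
        (Corner.outward₁-maximiser-depth low low W W-max)
        (<-by-difference _ refl (Corner.outward₁-maximiser-depth low high W W-max)) ,
      large-step₂-≥2 Γ |det|≡n (vertices∈Γ S (lex-extreme-is-vertex {P} -e₂ -e₁ (λ ()) S-lex))
        (Corner.outward₂-maximiser-depth low low S S-max)
        (<-by-difference _ refl (Corner.outward₂-maximiser-depth high low S S-max))
      where
      x₀∈P = proj₁ (proj₂ (CrossesAxesPositively.φ<0 (Corner.crosses low low)))
      W = proj₁ (lex-extreme-exists P x₀∈P -e₁ -e₂)
      W-lex = proj₂ (lex-extreme-exists P x₀∈P -e₁ -e₂)
      W-max : Maximiser P -e₁ W
      W-max = proj₁ W-lex , proj₁ (proj₂ W-lex)
      S = proj₁ (lex-extreme-exists P x₀∈P -e₂ -e₁)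
      S-lex = proj₂ (lex-extreme-exists P x₀∈P -e₂ -e₁)
      S-max : Maximiser P -e₂ S
      S-max = proj₁ S-lex , proj₁ (proj₂ S-lex)

lemma3p14 : (n : ℕ) → 3 ℕ.≤ n → (P : IntPolygon)
    → (∀ (k₁ k₂ : ℤ) → ¬ (toPt ((+ n) *ℤ k₁ , (+ n) *ℤ k₂) ∈P P))
    → SegmentSplits (toPt (+ 0 , + 0)) (toPt (+ n , + 0)) P
    → SegmentSplits (toPt (+ n , + 0)) (toPt (+ n , + n)) P
    → SegmentSplits (toPt (+ 0 , + n)) (toPt (+ n , + n)) P
    → SegmentSplits (toPt (+ 0 , + 0)) (toPt (+ 0 , + n)) P
    → (∀ A B → IsSPlus P A → IsEMinus P B
         → FrameSplits (+ n , + 0) (-[1+ 0 ] , + 0) (+ 0 , + 1) A B (Q₁ P))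
    × (∀ A B → IsEPlus P A → IsNPlus P B
         → FrameSplits (+ n , + n) (-[1+ 0 ] , + 0) (+ 0 , -[1+ 0 ]) A B (Q₂ P))
    × (∀ A B → IsNMinus P A → IsWPlus P B
         → FrameSplits (+ 0 , + n) (+ 1 , + 0) (+ 0 , -[1+ 0 ]) A B (Q₃ P))
    × (∀ A B → IsWMinus P A → IsSMinus P B
         → FrameSplits (+ 0 , + 0) (+ 1 , + 0) (+ 0 , + 1) A B (Q₄ P))
    × ((Γ : Mat) → Is1nLattice n Γ → (∀ x → IsVertex P x → x ∈Γℚ Γ)
         → (∀ s → IsLargeStep₁ Γ s → 2 ℕ.≤ s) × (∀ s → IsLargeStep₂ Γ s → 2 ℕ.≤ s))
lemma3p14 n 3≤n P no-multiple-of-n bottom right top left =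
  (λ A B (A∈P , A-max , _) (B∈P , B-max , _) → Corner.frame-splits-swapped high low A B (A∈P , A-max) (B∈P , B-max)) ,
  (λ A B (A∈P , A-max , _) (B∈P , B-max , _) → Corner.frame-splits high high A B (A∈P , A-max) (B∈P , B-max)) ,
  (λ A B (A∈P , A-max , _) (B∈P , B-max , _) → Corner.frame-splits-swapped low high A B (A∈P , A-max) (B∈P , B-max)) ,
  (λ A B (A∈P , A-max , _) (B∈P , B-max , _) → Corner.frame-splits low low A B (A∈P , A-max) (B∈P , B-max)) ,
  large-steps-≥2
  where
  open Square n
  -- only n > 0 is used
  open Splitting {P} (ℕ.≤-trans (s≤s z≤n) 3≤n) no-multiple-of-n bottom right top left
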